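{- None of the $5$-colored graphs $GP_5(3^4)$, $GP_5(7^4)$, $GP_5(2^8)$ is totally symmetric.
   Context: A $k$-colored graph $\Gamma=(V,\psi)$ is a complete graph on a finite vertex set $V$ together with a surjective map $\psi$ from its set of edges onto the set of colors $\{0,1,\ldots,k-1\}$. The automorphism group $Aut(\Gamma)$ is the group of permutations of $V$ preserving the color of every edge. The extended automorphism group $Ext(\Gamma)$ is the group of permutations of $V$ that permute the color classes of edges. $\Gamma$ is edge-transitive if $Aut(\Gamma)$ is transitive on the set of edges of each color; $\Gamma$ is color-symmetric if $Ext(\Gamma)$ induces the full symmetric group on the set of colors; $\Gamma$ is totally symmetric if it is both edge-transitive and color-symmetric. For a prime power $q$ with $q\equiv 1 \pmod 5$ such that $q$ is even or $(q-1)/5$ is even, and a primitive root $\omega$ of the field $F_q$, the generalized Paley graph $GP_5(q)$ is the $5$-colored graph with vertex set $F_q$ in which the edge between distinct $x,y\in F_q$ has color $i\in\{0,1,2,3,4\}$ if $x-y=\omega^{5m+i}$ for some integer $m$. -}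

module Defs where

open import Data.Nat using (ℕ; zero; suc; _+_; _*_; _∸_; NonZero)
open import Data.Nat.DivMod using (_mod_)
open import Data.Fin using (Fin; toℕ; #_)
open import Data.Vec using (Vec; []; _∷_; zipWith; map; replicate; init; last; toList)
open import Data.List using (foldr)
open import Data.Product using (_×_; ∃; Σ-syntax)
open import Data.Sum using (_⊎_)
open import Function.Bundles using (_↔_; Inverse)
open import Relation.Binary.PropositionalEquality using (_≡_; _≢_)

-- The finite field F_{p^(suc m)} realised as F_p[x]/(f), where
-- f = x^(suc m) + fs_m x^m + ... + fs_0 is a monic irreducible polynomial
-- (fs lists the lower coefficients, constant term first).
-- An element is its coefficient vector (constant term first).
module GF (p m : ℕ) .{{_ : NonZero p}} (fs : Vec (Fin p) (suc m)) where

  _+ₚ_ : Fin p → Fin p → Fin p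
  a +ₚ b = (toℕ a + toℕ b) mod p

  _*ₚ_ : Fin p → Fin p → Fin p
  a *ₚ b = (toℕ a * toℕ b) mod p

  negₚ : Fin p → Fin p
  negₚ a = (p ∸ toℕ a) mod p

  0ₚ : Fin p
  0ₚ = 0 mod p

  1ₚ : Fin p
  1ₚ = 1 mod p

  F : Set
  F = Vec (Fin p) (suc m)

  0F : F
  0F = replicate (suc m) 0ₚ

  1F : F
  1F = 1ₚ ∷ replicate m 0ₚ

  _+F_ : F → F → F
  _+F_ = zipWith _+ₚ_

  negF : F → F
  negF = map negₚ

  _-F_ : F → F → F
  a -F b = a +F negF b

  scale : Fin p → F → F
  scale c = map (c *ₚ_)

  -- multiplication by x, reducing with x^(suc m) = -(fs_0 + ... + fs_m x^m)
  mulX : F → F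
  mulX v = (0ₚ ∷ init v) +F scale (negₚ (last v)) fs

  -- a * b = a_0 b + x (a_1 b + x (a_2 b + ...))   (Horner)
  _*F_ : F → F → F
  a *F b = foldr (λ c acc → scale c b +F mulX acc) 0F (toList a)

  _^F_ : F → ℕ → F
  a ^F zero = 1F
  a ^F suc k = a *F (a ^F k)

  PrimitiveRoot : F → Set
  PrimitiveRoot ω = ∀ (a : F) → a ≢ 0F → ∃ λ k → ω ^F k ≡ a

  -- Generalized Paley graph GP_5(q) w.r.t. ω:
  -- the edge {x,y} (x ≢ y) has colour i iff x - y = ω^(5k+i) for some k.
  HasColour : F → F → F → Fin 5 → Set
  HasColour ω x y i = ∃ λ k → x -F y ≡ ω ^F (5 * k + toℕ i)

  IsAut : F → F ↔ F → Set
  IsAut ω σ = ∀ (x y : F) (i : Fin 5) → x ≢ y → HasColour ω x y i →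
              HasColour ω (Inverse.to σ x) (Inverse.to σ y) i

  EdgeTransitive : F → Set
  EdgeTransitive ω =
    ∀ (x y u v : F) (i : Fin 5) → x ≢ y → u ≢ v →
    HasColour ω x y i → HasColour ω u v i →
    Σ[ σ ∈ F ↔ F ] (IsAut ω σ ×
      ((Inverse.to σ x ≡ u × Inverse.to σ y ≡ v) ⊎
       (Inverse.to σ x ≡ v × Inverse.to σ y ≡ u)))

  -- Ext(Γ) induces the full symmetric group on the colours: every permutation
  -- π of the colours is induced by some permutation σ of the vertices.
  ColourSymmetric : F → Set
  ColourSymmetric ω =
    ∀ (π : Fin 5 ↔ Fin 5) → Σ[ σ ∈ F ↔ F ]
      (∀ (x y : F) (i : Fin 5) → x ≢ y → HasColour ω x y i →
        HasColour ω (Inverse.to σ x) (Inverse.to σ y) (Inverse.to π i))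

  TotallySymmetric : F → Set
  TotallySymmetric ω = EdgeTransitive ω × ColourSymmetric ω

-- F_81 = F_3[x]/(x^4 + x + 2)
module GF81 = GF 3 3 (# 2 ∷ # 1 ∷ # 0 ∷ # 0 ∷ [])
-- F_2401 = F_7[x]/(x^4 + x + 1)
module GF2401 = GF 7 3 (# 1 ∷ # 1 ∷ # 0 ∷ # 0 ∷ [])
-- F_256 = F_2[x]/(x^8 + x^4 + x^3 + x + 1)
module GF256 = GF 2 7 (# 1 ∷ # 1 ∷ # 0 ∷ # 1 ∷ # 1 ∷ # 0 ∷ # 0 ∷ # 0 ∷ [])

module Submission where

open import Defs
open import Algebra.Bundles using (CommutativeRing; CommutativeMonoid)
open import Algebra.Consequences.Propositional
  using (comm∧idˡ⇒id; comm∧idˡ⇒idʳ; comm∧invʳ⇒inv; comm∧invʳ⇒invˡ; comm∧distrˡ⇒distr)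
open import Algebra.Module.Bundles using (LeftModule)
open import Algebra.Structures using (IsCommutativeRing)
open import Data.Bool using (if_then_else_)
open import Data.Fin using (Fin; toℕ; _≟_; #_)
import Data.Fin as Fin
open import Data.Fin.Properties using (toℕ-injective; toℕ-fromℕ<; toℕ<n)
import Data.Fin.Properties as Fin
open import Data.List using (List; []; _∷_; [_]; foldr; cartesianProductWith; upTo; allFin; length; filter)
import Data.List as List
open import Data.List.Membership.Propositional using (_∈_; _─_)
open import Data.List.Membership.Propositional.Properties
  using (∈-cartesianProductWith⁺; ∈-upTo⁺; ∈-allFin; ∈-map⁺; ∈-map⁻; ∈-filter⁺)
open import Data.List.Properties using (length-removeAt′; length-map)
open import Data.List.Relation.Binary.Subset.Propositional using (_⊆_)
open import Data.List.Relation.Unary.All using (All; all?)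
import Data.List.Relation.Unary.All as All
open import Data.List.Relation.Unary.AllPairs using (_∷_; [])
open import Data.List.Relation.Unary.Any using (here; there; index)
open import Data.List.Relation.Unary.Unique.Propositional using (Unique)
import Data.List.Relation.Unary.Unique.Propositional.Properties as Unique
open import Data.Nat using (ℕ; zero; suc; _+_; _*_; _∸_; _<_; _≤_; z≤n; s≤s; NonZero; nonZero; >-nonZero⁻¹)
import Data.Nat as ℕ
open import Data.Nat.Divisibility using (m∣m*n)
open import Data.Nat.Solver using (module +-*-Solver)
open import Data.Nat.DivMod
  using (_mod_; _%_; _/_; %-distribˡ-+; %-distribˡ-*; m%n%n≡m%n; n%n≡0; m<n⇒m%n≡m; m%n<n;
         m∣n⇒o%n%m≡o%m; [m+kn]%n≡m%n; [m+n]%n≡m%n; m<n*o⇒m/o<n; m≡m%n+[m/n]*n)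
open import Data.Nat.Properties
  using (+-assoc; +-comm; *-assoc; *-comm; *-identityˡ; *-zeroʳ; *-distribˡ-+; *-distribʳ-+;
         +-commutativeSemigroup; m+[n∸m]≡n; m∸n+n≡m; m*n≢0; <-irrefl; <⇒≤; <⇒≢; <⇒≱; 0≢1+n)
open import Data.Product using (_×_; _,_; proj₁; proj₂; ∃)
open import Data.Sum using (_⊎_; inj₁; inj₂)
open import Data.Vec using (Vec; []; _∷_; lookup; map; zipWith; replicate; init; last; toList)
open import Data.Vec.Properties
  using (≡-dec; map-cong; map-const; map-id; map-∘; map-replicate; zipWith-assoc; zipWith-comm;
         zipWith-identityˡ; zipWith-identityʳ; zipWith-inverseˡ; zipWith-inverseʳ)
open import Function using (_∘_; case_of_)
open import Function.Bundles using (_↔_; mk↔ₛ′; Inverse)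
open import Level using (0ℓ)
open import Relation.Binary.Definitions using (DecidableEquality)
open import Relation.Binary.PropositionalEquality
  using (_≡_; _≢_; refl; sym; trans; cong; cong₂; subst; isEquivalence; module ≡-Reasoning)
open import Relation.Nullary using (¬_; Dec; yes; no; does; ¬?; _×-dec_; _⊎-dec_; _→-dec_; map′; contradiction)
open import Relation.Nullary.Decidable using (dec-true; dec-false; decidable-stable; toWitness)

-- Fix a generator g of 𝔽_q^* and call ind x mod 5 the class of x ≠ 0, where g ^ ind x = x. A primitive root ω
-- is g^d with 5 ∤ d, and the edges of colour i of GP₅(q) are the pairs whose difference has class i·d mod 5.
-- Hence colour symmetry yields a vertex permutation σ under which the class of σx − σy is the class of x − y
-- with classes 0 and 1 exchanged. Translating σ and multiplying it by a fifth power of g, which preserves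
-- classes, we may assume that σ also fixes 0 and a suitable power r = g^c. For a well-chosen vertex a, the
-- vertices b sharing the classes of b, b − r and b − a form a set A which σ maps injectively into a set
-- determined by σ a; a computation shows that for every value σ a can take that set has fewer than |A|
-- elements. The finite facts (discrete-logarithm tables, associativity of multiplication by g, which is
-- bilinear and hence checked on a basis, and the counting bound) are decided by evaluation.

module _ (d : ℕ) .{{_ : NonZero d}} where

  [m%d+n]%d≡[m+n]%d : ∀ m n → (m % d + n) % d ≡ (m + n) % d
  [m%d+n]%d≡[m+n]%d m n = begin
    (m % d + n) % d            ≡⟨ %-distribˡ-+ (m % d) n d ⟩
    (m % d % d + n % d) % d    ≡⟨ cong (λ k → (k + n % d) % d) (m%n%n≡m%n m d) ⟩
    (m % d + n % d) % d        ≡⟨ %-distribˡ-+ m n d ⟨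
    (m + n) % d                ∎
    where open ≡-Reasoning

  [m+n%d]%d≡[m+n]%d : ∀ m n → (m + n % d) % d ≡ (m + n) % d
  [m+n%d]%d≡[m+n]%d m n = begin
    (m + n % d) % d  ≡⟨ cong (_% d) (+-comm m (n % d)) ⟩
    (n % d + m) % d  ≡⟨ [m%d+n]%d≡[m+n]%d n m ⟩
    (n + m) % d      ≡⟨ cong (_% d) (+-comm n m) ⟩
    (m + n) % d      ∎
    where open ≡-Reasoning

  [m%d*n]%d≡[m*n]%d : ∀ m n → (m % d * n) % d ≡ (m * n) % d
  [m%d*n]%d≡[m*n]%d m n = begin
    (m % d * n) % d            ≡⟨ %-distribˡ-* (m % d) n d ⟩
    (m % d % d * (n % d)) % d  ≡⟨ cong (λ k → (k * (n % d)) % d) (m%n%n≡m%n m d) ⟩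
    (m % d * (n % d)) % d      ≡⟨ %-distribˡ-* m n d ⟨
    (m * n) % d                ∎
    where open ≡-Reasoning

  [m*n%d]%d≡[m*n]%d : ∀ m n → (m * (n % d)) % d ≡ (m * n) % d
  [m*n%d]%d≡[m*n]%d m n = begin
    (m * (n % d)) % d  ≡⟨ cong (_% d) (*-comm m (n % d)) ⟩
    (n % d * m) % d    ≡⟨ [m%d*n]%d≡[m*n]%d n m ⟩
    (n * m) % d        ≡⟨ cong (_% d) (*-comm n m) ⟩
    (m * n) % d        ∎
    where open ≡-Reasoning

module _ {A B C : Set} (f : A → B → C) where

  init-zipWith : ∀ {n} (u : Vec A (suc n)) v → init (zipWith f u v) ≡ zipWith f (init u) (init v)
  init-zipWith {zero}  (a ∷ []) (b ∷ []) = refl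
  init-zipWith {suc n} (a ∷ u)  (b ∷ v)  = cong (f a b ∷_) (init-zipWith u v)

  last-zipWith : ∀ {n} (u : Vec A (suc n)) v → last (zipWith f u v) ≡ f (last u) (last v)
  last-zipWith {zero}  (a ∷ []) (b ∷ []) = refl
  last-zipWith {suc n} (a ∷ u)  (b ∷ v)  = last-zipWith u v

module _ {A B : Set} (f : A → B) where

  init-map : ∀ {n} (u : Vec A (suc n)) → init (map f u) ≡ map f (init u)
  init-map {zero}  (a ∷ []) = refl
  init-map {suc n} (a ∷ u)  = cong (f a ∷_) (init-map u)

  last-map : ∀ {n} (u : Vec A (suc n)) → last (map f u) ≡ f (last u)
  last-map {zero}  (a ∷ []) = refl
  last-map {suc n} (a ∷ u)  = last-map u

module _ {A : Set} where

  ∈-─⁺ : ∀ {x y : A} {ys} (x∈ys : x ∈ ys) → y ∈ ys → x ≢ y → y ∈ ys ─ x∈ys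
  ∈-─⁺ (here refl) (here refl) x≢y = contradiction refl x≢y
  ∈-─⁺ (here refl) (there y∈)  _   = y∈
  ∈-─⁺ (there x∈)  (here refl) _   = here refl
  ∈-─⁺ (there x∈)  (there y∈)  x≢y = there (∈-─⁺ x∈ y∈ x≢y)

  Unique-⊆⇒length≤ : ∀ {xs ys : List A} → Unique xs → xs ⊆ ys → length xs ≤ length ys
  Unique-⊆⇒length≤ []                       _     = z≤n
  Unique-⊆⇒length≤ {ys = ys} (x≢xs ∷ uniq) xs⊆ys =
    subst (_ ≤_) (sym (length-removeAt′ ys (index x∈ys)))
          (s≤s (Unique-⊆⇒length≤ uniq λ y∈xs → ∈-─⁺ x∈ys (xs⊆ys (there y∈xs)) (All.lookup x≢xs y∈xs)))
    where x∈ys = xs⊆ys (here refl)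

module FieldArithmetic (p m : ℕ) .{{_ : NonZero p}} (fs : Vec (Fin p) (suc m)) where
  open GF p m fs public

  toℕ-mod : ∀ n → toℕ (n mod p) ≡ n % p
  toℕ-mod n = toℕ-fromℕ< _

  mod-cong : ∀ {k n} → k % p ≡ n % p → k mod p ≡ n mod p
  mod-cong {k} {n} eq = toℕ-injective (trans (toℕ-mod k) (trans eq (sym (toℕ-mod n))))

  toℕ-mod-toℕ : ∀ (a : Fin p) → toℕ a mod p ≡ a
  toℕ-mod-toℕ a = toℕ-injective (trans (toℕ-mod (toℕ a)) (m<n⇒m%n≡m (toℕ<n a)))

  +ₚ-assoc : ∀ a b c → (a +ₚ b) +ₚ c ≡ a +ₚ (b +ₚ c)
  +ₚ-assoc a b c = mod-cong (begin
    (toℕ ((x + y) mod p) + z) % p  ≡⟨ cong (λ k → (k + z) % p) (toℕ-mod (x + y)) ⟩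
    ((x + y) % p + z) % p          ≡⟨ [m%d+n]%d≡[m+n]%d p (x + y) z ⟩
    (x + y + z) % p                ≡⟨ cong (_% p) (+-assoc x y z) ⟩
    (x + (y + z)) % p              ≡⟨ [m+n%d]%d≡[m+n]%d p x (y + z) ⟨
    (x + (y + z) % p) % p          ≡⟨ cong (λ k → (x + k) % p) (toℕ-mod (y + z)) ⟨
    (x + toℕ ((y + z) mod p)) % p  ∎)
    where open ≡-Reasoning; x = toℕ a; y = toℕ b; z = toℕ c

  +ₚ-comm : ∀ a b → a +ₚ b ≡ b +ₚ a
  +ₚ-comm a b = cong (_mod p) (+-comm (toℕ a) (toℕ b))

  +ₚ-identityˡ : ∀ a → 0ₚ +ₚ a ≡ a
  +ₚ-identityˡ a = trans (mod-cong (trans (cong (λ k → (k + toℕ a) % p) (toℕ-mod 0))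
                                           ([m%d+n]%d≡[m+n]%d p 0 (toℕ a))))
                         (toℕ-mod-toℕ a)

  +ₚ-inverseʳ : ∀ a → a +ₚ negₚ a ≡ 0ₚ
  +ₚ-inverseʳ a = mod-cong (begin
    (x + toℕ ((p ∸ x) mod p)) % p  ≡⟨ cong (λ k → (x + k) % p) (toℕ-mod (p ∸ x)) ⟩
    (x + (p ∸ x) % p) % p          ≡⟨ [m+n%d]%d≡[m+n]%d p x (p ∸ x) ⟩
    (x + (p ∸ x)) % p              ≡⟨ cong (_% p) (m+[n∸m]≡n (<⇒≤ (toℕ<n a))) ⟩
    p % p                          ≡⟨ m%n%n≡m%n p p ⟨
    p % p % p                      ≡⟨ cong (_% p) (n%n≡0 p) ⟩
    0 % p                          ∎)
    where open ≡-Reasoning; x = toℕ a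

  *ₚ-assoc : ∀ a b c → (a *ₚ b) *ₚ c ≡ a *ₚ (b *ₚ c)
  *ₚ-assoc a b c = mod-cong (begin
    (toℕ ((x * y) mod p) * z) % p  ≡⟨ cong (λ k → (k * z) % p) (toℕ-mod (x * y)) ⟩
    ((x * y) % p * z) % p          ≡⟨ [m%d*n]%d≡[m*n]%d p (x * y) z ⟩
    (x * y * z) % p                ≡⟨ cong (_% p) (*-assoc x y z) ⟩
    (x * (y * z)) % p              ≡⟨ [m*n%d]%d≡[m*n]%d p x (y * z) ⟨
    (x * ((y * z) % p)) % p        ≡⟨ cong (λ k → (x * k) % p) (toℕ-mod (y * z)) ⟨
    (x * toℕ ((y * z) mod p)) % p  ∎)
    where open ≡-Reasoning; x = toℕ a; y = toℕ b; z = toℕ c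

  *ₚ-comm : ∀ a b → a *ₚ b ≡ b *ₚ a
  *ₚ-comm a b = cong (_mod p) (*-comm (toℕ a) (toℕ b))

  *ₚ-identityˡ : ∀ a → 1ₚ *ₚ a ≡ a
  *ₚ-identityˡ a = trans (mod-cong (trans (cong (λ k → (k * toℕ a) % p) (toℕ-mod 1))
                                           ([m%d*n]%d≡[m*n]%d p 1 (toℕ a))))
                         (trans (cong (_mod p) (*-identityˡ (toℕ a))) (toℕ-mod-toℕ a))

  *ₚ-distribˡ-+ₚ : ∀ a b c → a *ₚ (b +ₚ c) ≡ (a *ₚ b) +ₚ (a *ₚ c)
  *ₚ-distribˡ-+ₚ a b c = mod-cong (begin
    (x * toℕ ((y + z) mod p)) % p                     ≡⟨ cong (λ k → (x * k) % p) (toℕ-mod (y + z)) ⟩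
    (x * ((y + z) % p)) % p                           ≡⟨ [m*n%d]%d≡[m*n]%d p x (y + z) ⟩
    (x * (y + z)) % p                                 ≡⟨ cong (_% p) (*-distribˡ-+ x y z) ⟩
    (x * y + x * z) % p                               ≡⟨ %-distribˡ-+ (x * y) (x * z) p ⟩
    ((x * y) % p + (x * z) % p) % p                   ≡⟨ cong₂ (λ k l → (k + l) % p) (toℕ-mod (x * y)) (toℕ-mod (x * z)) ⟨
    (toℕ ((x * y) mod p) + toℕ ((x * z) mod p)) % p   ∎)
    where open ≡-Reasoning; x = toℕ a; y = toℕ b; z = toℕ c

  ℤₚ-isCommutativeRing : IsCommutativeRing _≡_ _+ₚ_ _*ₚ_ negₚ 0ₚ 1ₚ
  ℤₚ-isCommutativeRing = record
    { isRing = record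
      { +-isAbelianGroup = record
        { isGroup = record
          { isMonoid = record
            { isSemigroup = record
              { isMagma = record { isEquivalence = isEquivalence ; ∙-cong = cong₂ _+ₚ_ }
              ; assoc = +ₚ-assoc }
            ; identity = comm∧idˡ⇒id +ₚ-comm +ₚ-identityˡ }
          ; inverse = comm∧invʳ⇒inv +ₚ-comm +ₚ-inverseʳ
          ; ⁻¹-cong = cong negₚ }
        ; comm = +ₚ-comm }
      ; *-cong = cong₂ _*ₚ_
      ; *-assoc = *ₚ-assoc
      ; *-identity = comm∧idˡ⇒id *ₚ-comm *ₚ-identityˡ
      ; distrib = comm∧distrˡ⇒distr (cong₂ _+ₚ_) *ₚ-comm *ₚ-distribˡ-+ₚ }
    ; *-comm = *ₚ-comm }

  ℤₚ : CommutativeRing 0ℓ 0ℓ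
  ℤₚ = record { isCommutativeRing = ℤₚ-isCommutativeRing }

  open CommutativeRing ℤₚ using (ring; zeroˡ; zeroʳ; distribʳ)
    renaming (+-identityʳ to +ₚ-identityʳ; *-identityʳ to *ₚ-identityʳ)

  vectorModule : ℕ → LeftModule ring 0ℓ 0ℓ
  vectorModule n = record
    { Carrierᴹ = Vec (Fin p) n
    ; _≈ᴹ_ = _≡_
    ; _+ᴹ_ = zipWith _+ₚ_
    ; _*ₗ_ = λ c → map (c *ₚ_)
    ; 0ᴹ = replicate n 0ₚ
    ; -ᴹ_ = map negₚ
    ; isLeftModule = record
      { isLeftSemimodule = record
        { +ᴹ-isCommutativeMonoid = record
          { isMonoid = record
            { isSemigroup = record
              { isMagma = record { isEquivalence = isEquivalence ; ∙-cong = cong₂ (zipWith _+ₚ_) }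
              ; assoc = zipWith-assoc +ₚ-assoc }
            ; identity = zipWith-identityˡ +ₚ-identityˡ , zipWith-identityʳ (comm∧idˡ⇒idʳ +ₚ-comm +ₚ-identityˡ) }
          ; comm = zipWith-comm +ₚ-comm }
        ; isPreleftSemimodule = record
          { *ₗ-cong = cong₂ (λ c → map (c *ₚ_))
          ; *ₗ-zeroˡ = λ u → trans (map-cong zeroˡ u) (map-const u 0ₚ)
          ; *ₗ-distribʳ = *ₗ-distribʳ
          ; *ₗ-identityˡ = λ u → trans (map-cong *ₚ-identityˡ u) (map-id u)
          ; *ₗ-assoc = λ c d u → trans (map-cong (*ₚ-assoc c d) u) (map-∘ (c *ₚ_) (d *ₚ_) u)
          ; *ₗ-zeroʳ = λ c → trans (map-replicate (c *ₚ_) 0ₚ n) (cong (replicate n) (zeroʳ c))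
          ; *ₗ-distribˡ = *ₗ-distribˡ } }
      ; -ᴹ‿cong = cong (map negₚ)
      ; -ᴹ‿inverse = zipWith-inverseˡ (comm∧invʳ⇒invˡ +ₚ-comm +ₚ-inverseʳ)
                   , zipWith-inverseʳ +ₚ-inverseʳ } }
    where
    *ₗ-distribʳ : ∀ {n} (u : Vec (Fin p) n) c d →
                  map ((c +ₚ d) *ₚ_) u ≡ zipWith _+ₚ_ (map (c *ₚ_) u) (map (d *ₚ_) u)
    *ₗ-distribʳ []      c d = refl
    *ₗ-distribʳ (a ∷ u) c d = cong₂ _∷_ (distribʳ a c d) (*ₗ-distribʳ u c d)

    *ₗ-distribˡ : ∀ {n} c (u v : Vec (Fin p) n) →
                  map (c *ₚ_) (zipWith _+ₚ_ u v) ≡ zipWith _+ₚ_ (map (c *ₚ_) u) (map (c *ₚ_) v)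
    *ₗ-distribˡ c []      []      = refl
    *ₗ-distribˡ c (a ∷ u) (b ∷ v) = cong₂ _∷_ (*ₚ-distribˡ-+ₚ c a b) (*ₗ-distribˡ c u v)

  module Vectors {n : ℕ} = LeftModule (vectorModule n)
  open Vectors using (_+ᴹ_; _*ₗ_; -ᴹ_; 0ᴹ; +ᴹ-identityˡ; +ᴹ-identityʳ; *ₗ-zeroˡ; *ₗ-zeroʳ;
                      *ₗ-distribˡ; *ₗ-distribʳ; *ₗ-assoc; *ₗ-identityˡ)

  +ᴹ-interchange : ∀ {n} (u v w x : Vec (Fin p) n) → (u +ᴹ v) +ᴹ (w +ᴹ x) ≡ (u +ᴹ w) +ᴹ (v +ᴹ x)
  +ᴹ-interchange {n} = interchange
    where open import Algebra.Properties.CommutativeSemigroup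
                        (CommutativeMonoid.commutativeSemigroup (Vectors.+ᴹ-commutativeMonoid {n}))

  *ₗ-comm : ∀ {n} c d (u : Vec (Fin p) n) → c *ₗ (d *ₗ u) ≡ d *ₗ (c *ₗ u)
  *ₗ-comm c d u = begin
    c *ₗ (d *ₗ u)  ≡⟨ *ₗ-assoc c d u ⟨
    (c *ₚ d) *ₗ u  ≡⟨ cong (_*ₗ u) (*ₚ-comm c d) ⟩
    (d *ₚ c) *ₗ u  ≡⟨ *ₗ-assoc d c u ⟩
    d *ₗ (c *ₗ u)  ∎
    where open ≡-Reasoning

  record IsLinear {k n} (f : Vec (Fin p) k → Vec (Fin p) n) : Set where
    field
      +ᴹ-homo : ∀ u v → f (u +ᴹ v) ≡ f u +ᴹ f v
      *ₗ-homo : ∀ c u → f (c *ₗ u) ≡ c *ₗ f u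

  module _ {k n} {f : Vec (Fin p) k → Vec (Fin p) n} (lin : IsLinear f) where
    open IsLinear lin

    linear-0ᴹ : f 0ᴹ ≡ 0ᴹ
    linear-0ᴹ = begin
      f 0ᴹ            ≡⟨ cong f (*ₗ-zeroˡ 0ᴹ) ⟨
      f (0ₚ *ₗ 0ᴹ)    ≡⟨ *ₗ-homo 0ₚ 0ᴹ ⟩
      0ₚ *ₗ f 0ᴹ      ≡⟨ *ₗ-zeroˡ (f 0ᴹ) ⟩
      0ᴹ              ∎
      where open ≡-Reasoning

    linear--ᴹ : ∀ u → f (-ᴹ u) ≡ -ᴹ f u
    linear--ᴹ u = inverseʳ-unique (f u) (f (-ᴹ u)) (begin
      f u +ᴹ f (-ᴹ u)  ≡⟨ +ᴹ-homo u (-ᴹ u) ⟨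
      f (u +ᴹ -ᴹ u)    ≡⟨ cong f (Vectors.-ᴹ‿inverseʳ u) ⟩
      f 0ᴹ             ≡⟨ linear-0ᴹ ⟩
      0ᴹ               ∎)
      where open ≡-Reasoning
            open import Algebra.Properties.AbelianGroup (Vectors.+ᴹ-abelianGroup {n})

    linear-sub : ∀ u v → f (u +ᴹ -ᴹ v) ≡ f u +ᴹ -ᴹ f v
    linear-sub u v = trans (+ᴹ-homo u (-ᴹ v)) (cong (f u +ᴹ_) (linear--ᴹ v))

  linear-∘ : ∀ {j k n} {f : Vec (Fin p) k → Vec (Fin p) n} {h : Vec (Fin p) j → Vec (Fin p) k} →
             IsLinear f → IsLinear h → IsLinear (f ∘ h)
  linear-∘ {f = f} {h} lf lh = record
    { +ᴹ-homo = λ u v → trans (cong f (IsLinear.+ᴹ-homo lh u v)) (IsLinear.+ᴹ-homo lf (h u) (h v))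
    ; *ₗ-homo = λ c u → trans (cong f (IsLinear.*ₗ-homo lh c u)) (IsLinear.*ₗ-homo lf c (h u)) }

  open import Algebra.Properties.Ring ring using (-‿+-comm; -‿distribʳ-*)

  mulX-linear : IsLinear mulX
  mulX-linear = record { +ᴹ-homo = +ᴹ-homo ; *ₗ-homo = *ₗ-homo }
    where
    open ≡-Reasoning

    +ᴹ-homo : ∀ u v → mulX (u +ᴹ v) ≡ mulX u +ᴹ mulX v
    +ᴹ-homo u v = begin
      (0ₚ ∷ init (u +ᴹ v)) +ᴹ negₚ (last (u +ᴹ v)) *ₗ fs
        ≡⟨ cong₂ (λ w l → (0ₚ ∷ w) +ᴹ negₚ l *ₗ fs) (init-zipWith _+ₚ_ u v) (last-zipWith _+ₚ_ u v) ⟩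
      (0ₚ ∷ (init u +ᴹ init v)) +ᴹ negₚ (last u +ₚ last v) *ₗ fs
        ≡⟨ cong₂ (λ z c → (z ∷ (init u +ᴹ init v)) +ᴹ c *ₗ fs) (+ₚ-identityˡ 0ₚ) (-‿+-comm (last u) (last v)) ⟨
      ((0ₚ ∷ init u) +ᴹ (0ₚ ∷ init v)) +ᴹ (negₚ (last u) +ₚ negₚ (last v)) *ₗ fs
        ≡⟨ cong (((0ₚ ∷ init u) +ᴹ (0ₚ ∷ init v)) +ᴹ_) (*ₗ-distribʳ fs (negₚ (last u)) (negₚ (last v))) ⟩
      ((0ₚ ∷ init u) +ᴹ (0ₚ ∷ init v)) +ᴹ (negₚ (last u) *ₗ fs +ᴹ negₚ (last v) *ₗ fs)
        ≡⟨ +ᴹ-interchange _ _ _ _ ⟩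
      mulX u +ᴹ mulX v
        ∎

    *ₗ-homo : ∀ c u → mulX (c *ₗ u) ≡ c *ₗ mulX u
    *ₗ-homo c u = begin
      (0ₚ ∷ init (c *ₗ u)) +ᴹ negₚ (last (c *ₗ u)) *ₗ fs
        ≡⟨ cong₂ (λ w l → (0ₚ ∷ w) +ᴹ negₚ l *ₗ fs) (init-map (c *ₚ_) u) (last-map (c *ₚ_) u) ⟩
      (0ₚ ∷ c *ₗ init u) +ᴹ negₚ (c *ₚ last u) *ₗ fs
        ≡⟨ cong₂ (λ z d → (z ∷ c *ₗ init u) +ᴹ d *ₗ fs) (sym (zeroʳ c)) (-‿distribʳ-* c (last u)) ⟩
      c *ₗ (0ₚ ∷ init u) +ᴹ (c *ₚ negₚ (last u)) *ₗ fs
        ≡⟨ cong (c *ₗ (0ₚ ∷ init u) +ᴹ_) (*ₗ-assoc c (negₚ (last u)) fs) ⟩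
      c *ₗ (0ₚ ∷ init u) +ᴹ c *ₗ (negₚ (last u) *ₗ fs)
        ≡⟨ *ₗ-distribˡ c _ _ ⟨
      c *ₗ mulX u
        ∎

  -- a *F b unfolds to horner a b; allowing coefficient vectors of any length k makes linearity provable by
  -- induction.
  horner : ∀ {k} → Vec (Fin p) k → F → F
  horner a b = foldr (λ c acc → scale c b +F mulX acc) 0F (toList a)

  horner-linearʳ : ∀ {k} (a : Vec (Fin p) k) → IsLinear (horner a)
  horner-linearʳ a = record { +ᴹ-homo = +ᴹ-homo a ; *ₗ-homo = *ₗ-homo a }
    where
    open IsLinear mulX-linear
      renaming (+ᴹ-homo to mulX-+ᴹ-homo; *ₗ-homo to mulX-*ₗ-homo)
    open ≡-Reasoning

    +ᴹ-homo : ∀ {k} (a : Vec (Fin p) k) u v → horner a (u +ᴹ v) ≡ horner a u +ᴹ horner a v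
    +ᴹ-homo []      u v = sym (+ᴹ-identityˡ 0ᴹ)
    +ᴹ-homo (c ∷ a) u v = begin
      c *ₗ (u +ᴹ v) +ᴹ mulX (horner a (u +ᴹ v))
        ≡⟨ cong₂ _+ᴹ_ (*ₗ-distribˡ c u v) (trans (cong mulX (+ᴹ-homo a u v)) (mulX-+ᴹ-homo _ _)) ⟩
      (c *ₗ u +ᴹ c *ₗ v) +ᴹ (mulX (horner a u) +ᴹ mulX (horner a v))
        ≡⟨ +ᴹ-interchange _ _ _ _ ⟩
      horner (c ∷ a) u +ᴹ horner (c ∷ a) v
        ∎

    *ₗ-homo : ∀ {k} (a : Vec (Fin p) k) d u → horner a (d *ₗ u) ≡ d *ₗ horner a u
    *ₗ-homo []      d u = sym (*ₗ-zeroʳ d)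
    *ₗ-homo (c ∷ a) d u = begin
      c *ₗ (d *ₗ u) +ᴹ mulX (horner a (d *ₗ u))
        ≡⟨ cong₂ _+ᴹ_ (*ₗ-comm c d u) (trans (cong mulX (*ₗ-homo a d u)) (mulX-*ₗ-homo d _)) ⟩
      d *ₗ (c *ₗ u) +ᴹ d *ₗ mulX (horner a u)
        ≡⟨ *ₗ-distribˡ d _ _ ⟨
      d *ₗ horner (c ∷ a) u
        ∎

  horner-linearˡ : ∀ {k} (b : F) → IsLinear (λ (a : Vec (Fin p) k) → horner a b)
  horner-linearˡ b = record { +ᴹ-homo = +ᴹ-homo ; *ₗ-homo = *ₗ-homo }
    where
    open IsLinear mulX-linear
      renaming (+ᴹ-homo to mulX-+ᴹ-homo; *ₗ-homo to mulX-*ₗ-homo)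
    open ≡-Reasoning

    +ᴹ-homo : ∀ {k} (a a′ : Vec (Fin p) k) → horner (a +ᴹ a′) b ≡ horner a b +ᴹ horner a′ b
    +ᴹ-homo []      []        = sym (+ᴹ-identityˡ 0ᴹ)
    +ᴹ-homo (c ∷ a) (c′ ∷ a′) = begin
      (c +ₚ c′) *ₗ b +ᴹ mulX (horner (a +ᴹ a′) b)
        ≡⟨ cong₂ _+ᴹ_ (*ₗ-distribʳ b c c′) (trans (cong mulX (+ᴹ-homo a a′)) (mulX-+ᴹ-homo _ _)) ⟩
      (c *ₗ b +ᴹ c′ *ₗ b) +ᴹ (mulX (horner a b) +ᴹ mulX (horner a′ b))
        ≡⟨ +ᴹ-interchange _ _ _ _ ⟩
      horner (c ∷ a) b +ᴹ horner (c′ ∷ a′) b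
        ∎

    *ₗ-homo : ∀ {k} d (a : Vec (Fin p) k) → horner (d *ₗ a) b ≡ d *ₗ horner a b
    *ₗ-homo d []      = sym (*ₗ-zeroʳ d)
    *ₗ-homo d (c ∷ a) = begin
      (d *ₚ c) *ₗ b +ᴹ mulX (horner (d *ₗ a) b)
        ≡⟨ cong₂ _+ᴹ_ (*ₗ-assoc d c b) (trans (cong mulX (*ₗ-homo d a)) (mulX-*ₗ-homo d _)) ⟩
      d *ₗ (c *ₗ b) +ᴹ d *ₗ mulX (horner a b)
        ≡⟨ *ₗ-distribˡ d _ _ ⟨
      d *ₗ horner (c ∷ a) b
        ∎

  *F-zeroˡ : ∀ b → 0F *F b ≡ 0F
  *F-zeroˡ b = linear-0ᴹ (horner-linearˡ {suc m} b)

  *F-identityˡ : ∀ b → 1F *F b ≡ b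
  *F-identityˡ b = begin
    1ₚ *ₗ b +ᴹ mulX (horner (replicate m 0ₚ) b)  ≡⟨ cong (λ x → 1ₚ *ₗ b +ᴹ mulX x) (linear-0ᴹ (horner-linearˡ {m} b)) ⟩
    1ₚ *ₗ b +ᴹ mulX 0F                           ≡⟨ cong₂ _+ᴹ_ (*ₗ-identityˡ b) (linear-0ᴹ mulX-linear) ⟩
    b +ᴹ 0F                                      ≡⟨ +ᴹ-identityʳ b ⟩
    b                                            ∎
    where open ≡-Reasoning

  linComb : ∀ {k n} → Vec (Fin p) k → Vec (Vec (Fin p) n) k → Vec (Fin p) n
  linComb []       []       = 0ᴹ
  linComb (c ∷ cs) (e ∷ es) = c *ₗ e +ᴹ linComb cs es

  linear-linComb : ∀ {n l} {f : Vec (Fin p) n → Vec (Fin p) l} → IsLinear f →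
                   ∀ {k} (cs : Vec (Fin p) k) es → f (linComb cs es) ≡ linComb cs (map f es)
  linear-linComb lin []       []       = linear-0ᴹ lin
  linear-linComb lin (c ∷ cs) (e ∷ es) =
    trans (IsLinear.+ᴹ-homo lin _ _)
          (cong₂ _+ᴹ_ (IsLinear.*ₗ-homo lin c e) (linear-linComb lin cs es))

  basis : ∀ n → Vec (Vec (Fin p) n) n
  basis zero    = []
  basis (suc n) = (1ₚ ∷ 0ᴹ) ∷ map (0ₚ ∷_) (basis n)

  linComb-basis : ∀ {n} (u : Vec (Fin p) n) → linComb u (basis n) ≡ u
  linComb-basis []      = refl
  linComb-basis (c ∷ u) = begin
    c *ₗ (1ₚ ∷ 0ᴹ) +ᴹ linComb u (map (0ₚ ∷_) (basis _))   ≡⟨ cong (c *ₗ (1ₚ ∷ 0ᴹ) +ᴹ_) (linComb-shift u (basis _)) ⟩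
    ((c *ₚ 1ₚ) +ₚ 0ₚ) ∷ (c *ₗ 0ᴹ +ᴹ linComb u (basis _))  ≡⟨ cong₂ _∷_ head-coefficient tail-coefficients ⟩
    c ∷ u                                                  ∎
    where
    open ≡-Reasoning

    linComb-shift : ∀ {k n} (cs : Vec (Fin p) k) (es : Vec (Vec (Fin p) n) k) →
                    linComb cs (map (0ₚ ∷_) es) ≡ 0ₚ ∷ linComb cs es
    linComb-shift []       []       = refl
    linComb-shift (c ∷ cs) (e ∷ es) = begin
      c *ₗ (0ₚ ∷ e) +ᴹ linComb cs (map (0ₚ ∷_) es)  ≡⟨ cong (c *ₗ (0ₚ ∷ e) +ᴹ_) (linComb-shift cs es) ⟩
      ((c *ₚ 0ₚ) +ₚ 0ₚ) ∷ (c *ₗ e +ᴹ linComb cs es)   ≡⟨ cong (_∷ (c *ₗ e +ᴹ linComb cs es)) (trans (+ₚ-identityʳ (c *ₚ 0ₚ)) (zeroʳ c)) ⟩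
      0ₚ ∷ linComb (c ∷ cs) (e ∷ es)                 ∎

    head-coefficient : (c *ₚ 1ₚ) +ₚ 0ₚ ≡ c
    head-coefficient = trans (+ₚ-identityʳ (c *ₚ 1ₚ)) (*ₚ-identityʳ c)

    tail-coefficients : c *ₗ 0ᴹ +ᴹ linComb u (basis _) ≡ u
    tail-coefficients = trans (cong₂ _+ᴹ_ (*ₗ-zeroʳ c) (linComb-basis u)) (+ᴹ-identityˡ u)

  onBasis : (F → F → F) → Vec (Vec F (suc m)) (suc m)
  onBasis B = map (λ e → map (B e) (basis (suc m))) (basis (suc m))

  bilinear-expand : ∀ {B : F → F → F} → (∀ b → IsLinear (λ a → B a b)) → (∀ a → IsLinear (B a)) →
                    ∀ a b → B a b ≡ linComb a (map (linComb b) (onBasis B))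
  bilinear-expand {B} linˡ linʳ a b = begin
    B a b                                                             ≡⟨ cong (λ x → B x b) (linComb-basis a) ⟨
    B (linComb a es) b                                                ≡⟨ linear-linComb (linˡ b) a es ⟩
    linComb a (map (λ e → B e b) es)                                  ≡⟨ cong (linComb a) (map-cong expandʳ es) ⟩
    linComb a (map (λ e → linComb b (map (B e) es)) es)              ≡⟨ cong (linComb a) (map-∘ (linComb b) (λ e → map (B e) es) es) ⟩
    linComb a (map (linComb b) (onBasis B))                           ∎
    where
    open ≡-Reasoning
    es = basis (suc m)

    expandʳ : ∀ e → B e b ≡ linComb b (map (B e) es)
    expandʳ e = trans (cong (B e) (sym (linComb-basis b))) (linear-linComb (linʳ e) b es)

  *F-assoc-onBasis : ∀ g → onBasis (λ a b → (g *F a) *F b) ≡ onBasis (λ a b → g *F (a *F b)) →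
                     ∀ a b → (g *F a) *F b ≡ g *F (a *F b)
  *F-assoc-onBasis g agree a b = begin
    (g *F a) *F b                            ≡⟨ bilinear-expand {L} (λ b → linear-∘ (horner-linearˡ b) (horner-linearʳ g))
                                                                    (λ a → horner-linearʳ (g *F a)) a b ⟩
    linComb a (map (linComb b) (onBasis L))  ≡⟨ cong (λ T → linComb a (map (linComb b) T)) agree ⟩
    linComb a (map (linComb b) (onBasis R))  ≡⟨ bilinear-expand {R} (λ b → linear-∘ (horner-linearʳ g) (horner-linearˡ b))
                                                                    (λ a → linear-∘ (horner-linearʳ g) (horner-linearʳ a)) a b ⟨
    g *F (a *F b)                            ∎
    where
    open ≡-Reasoning
    L R : F → F → F
    L a b = (g *F a) *F b
    R a b = g *F (a *F b)

  module _ where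
    open import Algebra.Properties.AbelianGroup (Vectors.+ᴹ-abelianGroup {suc m})
    open ≡-Reasoning

    -F≡0F⇒≡ : ∀ {x y} → x -F y ≡ 0F → x ≡ y
    -F≡0F⇒≡ {x} {y} = x∙y⁻¹≈ε⇒x≈y x y

    x-F0F≡x : ∀ x → x -F 0F ≡ x
    x-F0F≡x x = trans (cong (x +F_) ε⁻¹≈ε) (Vectors.+ᴹ-identityʳ x)

    x-Fx≡0F : ∀ x → x -F x ≡ 0F
    x-Fx≡0F = Vectors.-ᴹ‿inverseʳ

    [x-Fz]-F[y-Fz]≡x-Fy : ∀ x y z → (x -F z) -F (y -F z) ≡ x -F y
    [x-Fz]-F[y-Fz]≡x-Fy x y z = begin
      (x +F negF z) +F negF (y +F negF z)         ≡⟨ cong ((x +F negF z) +F_) (⁻¹-∙-comm y (negF z)) ⟨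
      (x +F negF z) +F (negF y +F negF (negF z))  ≡⟨ +ᴹ-interchange x (negF z) (negF y) (negF (negF z)) ⟩
      (x +F negF y) +F (negF z +F negF (negF z))  ≡⟨ cong ((x +F negF y) +F_) (Vectors.-ᴹ‿inverseʳ (negF z)) ⟩
      (x +F negF y) +F 0F                         ≡⟨ Vectors.+ᴹ-identityʳ (x +F negF y) ⟩
      x +F negF y                                 ∎

-- A field element is coded by the natural number whose base-p digits are its coefficients. The discrete
-- logarithm tables are tries, keyed by the coefficients of an element and by the base-p digits of an exponent
-- respectively, so that every lookup takes m + 1 steps.
Trie : (p k : ℕ) → Set
Trie p zero    = ℕ
Trie p (suc k) = Vec (Trie p k) p

lookupTrie : ∀ {p k} → Trie p k → Vec (Fin p) k → ℕ
lookupTrie {k = zero}  t []      = t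
lookupTrie {k = suc k} t (a ∷ v) = lookupTrie (lookup t a) v

digits : (p k : ℕ) .{{_ : NonZero p}} → ℕ → Vec (Fin p) k
digits p zero    n = []
digits p (suc k) n = n mod p ∷ digits p k (n / p)

vectors : ∀ {A : Set} → List A → (n : ℕ) → List (Vec A n)
vectors xs zero    = [ [] ]
vectors xs (suc n) = cartesianProductWith _∷_ xs (vectors xs n)

∈-vectors : ∀ {A : Set} {xs : List A} → (∀ x → x ∈ xs) → ∀ {n} (v : Vec A n) → v ∈ vectors xs n
∈-vectors all []      = here refl
∈-vectors all (x ∷ v) = ∈-cartesianProductWith⁺ _∷_ (all x) (∈-vectors all v)

swap01 : ℕ → ℕ
swap01 0 = 1
swap01 1 = 0
swap01 n = n

swap01≡5⇒≡5 : ∀ {n} → swap01 n ≡ 5 → n ≡ 5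
swap01≡5⇒≡5 {suc (suc n)} eq = eq

swap01<5 : ∀ {n} → n < 5 → swap01 n < 5
swap01<5 {0}           _   = s≤s (s≤s z≤n)
swap01<5 {1}           _   = s≤s z≤n
swap01<5 {suc (suc n)} n<5 = n<5

unitInverse₅ : Fin 5 → ℕ
unitInverse₅ t = lookup (0 ∷ 1 ∷ 3 ∷ 2 ∷ 4 ∷ []) t

-- If ω = g^d with d ≡ t (mod 5), colour i consists of the differences of class i·t, so the colour permutation
-- classSwap t corresponds to exchanging the classes 0 and 1.
classSwap : Fin 5 → Fin 5 → Fin 5
classSwap t i = (unitInverse₅ t * swap01 ((toℕ i * toℕ t) % 5)) mod 5

classSwap-involutive : ∀ t → t ≢ Fin.zero → ∀ i → classSwap t (classSwap t i) ≡ i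
classSwap-involutive = toWitness {a? = Fin.all? λ t → ¬? (t ≟ Fin.zero) →-dec Fin.all? λ i →
                                          classSwap t (classSwap t i) ≟ i} _

classSwap-conjugates : ∀ t → t ≢ Fin.zero → ∀ i →
                       (toℕ (classSwap t i) * toℕ t) % 5 ≡ swap01 ((toℕ i * toℕ t) % 5)
classSwap-conjugates = toWitness {a? = Fin.all? λ t → ¬? (t ≟ Fin.zero) →-dec Fin.all? λ i →
                                          (toℕ (classSwap t i) * toℕ t) % 5 ℕ.≟ swap01 ((toℕ i * toℕ t) % 5)} _

classSwap↔ : ∀ t → t ≢ Fin.zero → Fin 5 ↔ Fin 5
classSwap↔ t t≢0 = mk↔ₛ′ (classSwap t) (classSwap t) (classSwap-involutive t t≢0) (classSwap-involutive t t≢0)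

module CyclotomicClasses
  (p m : ℕ) .{{_ : NonZero p}} (fs : Vec (Fin p) (suc m))
  (g : GF.F p m fs) (M : ℕ) .{{_ : NonZero M}} (antilog log : Trie p (suc m))
  where

  open FieldArithmetic p m fs public

  N : ℕ
  N = 5 * M

  instance
    N-nonZero : NonZero N
    N-nonZero = m*n≢0 5 M

  infix 4 _≟F_
  _≟F_ : DecidableEquality F
  _≟F_ = ≡-dec _≟_

  ind⁻¹ : ℕ → F
  ind⁻¹ i = digits p (suc m) (lookupTrie antilog (digits p (suc m) i))

  ind : F → ℕ
  ind x = lookupTrie log x

  -- The class of 0F is the junk value 5, which no nonzero element has.
  classOf : F → ℕ
  classOf x = if does (x ≟F 0F) then 5 else ind x % 5

  elements : List F
  elements = vectors (allFin p) (suc m)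

  record ValidTables : Set where
    field
      assoc-onBasis : onBasis (λ a b → (g *F a) *F b) ≡ onBasis (λ a b → g *F (a *F b))
      ind⁻¹-0       : ind⁻¹ 0 ≡ 1F
      ind⁻¹-suc     : All (λ i → g *F ind⁻¹ i ≡ ind⁻¹ (suc i % N)) (upTo N)
      ind-ind⁻¹     : All (λ i → ind⁻¹ i ≢ 0F × ind (ind⁻¹ i) ≡ i) (upTo N)
      ind⁻¹-ind     : All (λ x → x ≡ 0F ⊎ ind x < N × ind⁻¹ (ind x) ≡ x) elements

  validTables? : Dec ValidTables
  validTables? = map′
    (λ (a , b , c , d , e) → record
      { assoc-onBasis = a ; ind⁻¹-0 = b ; ind⁻¹-suc = c ; ind-ind⁻¹ = d ; ind⁻¹-ind = e })
    (λ v → let open ValidTables v in assoc-onBasis , ind⁻¹-0 , ind⁻¹-suc , ind-ind⁻¹ , ind⁻¹-ind)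
    (       ≡-dec (≡-dec _≟F_) _ _
      ×-dec ind⁻¹ 0 ≟F 1F
      ×-dec all? (λ i → g *F ind⁻¹ i ≟F ind⁻¹ (suc i % N)) (upTo N)
      ×-dec all? (λ i → ¬? (ind⁻¹ i ≟F 0F) ×-dec ind (ind⁻¹ i) ℕ.≟ i) (upTo N)
      ×-dec all? (λ x → x ≟F 0F ⊎-dec ind x ℕ.<? N ×-dec ind⁻¹ (ind x) ≟F x) elements)

  classMembers : ℕ → List F
  classMembers k = List.map (λ j → ind⁻¹ (5 * j + k)) (upTo M)

  SwapsClasses : (F → F) → Set
  SwapsClasses σ = ∀ x y → classOf (σ x -F σ y) ≡ swap01 (classOf (x -F y))

  record Normalised (σ : F → F) (r : F) : Set where
    field
      swapsClasses : SwapsClasses σ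
      fixes-0F     : σ 0F ≡ 0F
      fixes-r      : σ r ≡ r

  -- If σ fixes 0 and r and exchanges the classes 0 and 1, then σ a lies in images r a, and every b with the
  -- classes e₀, e₁, e₂ of b, b − r, b − a is sent into candidates r e₀ e₁ e₂ (σ a).
  images : F → F → List F
  images r a = filter (λ w → classOf (w -F r) ℕ.≟ swap01 (classOf (a -F r)))
                      (classMembers (swap01 (classOf a)))

  candidates : F → ℕ → ℕ → ℕ → F → List F
  candidates r e₀ e₁ e₂ w = filter (λ y → classOf (y -F r) ℕ.≟ swap01 e₁ ×-dec classOf (y -F w) ℕ.≟ swap01 e₂)
                                   (classMembers (swap01 e₀))

  Profile : F → F → ℕ → ℕ → ℕ → F → Set
  Profile r a e₀ e₁ e₂ b = classOf b ≡ e₀ × classOf (b -F r) ≡ e₁ × classOf (b -F a) ≡ e₂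

  record Witness : Set where
    field
      c        : ℕ
      a        : F
      e₀ e₁ e₂ : ℕ
      A        : List F

  Refutes : Witness → Set
  Refutes w = c < 5 × swap01 c ≡ c × a ≢ 0F × e₀ < 5 × Unique A
            × All (Profile (g ^F c) a e₀ e₁ e₂) A
            × All (λ w′ → length (candidates (g ^F c) e₀ e₁ e₂ w′) < length A) (images (g ^F c) a)
    where open Witness w

  refutes? : ∀ w → Dec (Refutes w)
  refutes? w =
          c ℕ.<? 5 ×-dec swap01 c ℕ.≟ c ×-dec ¬? (a ≟F 0F) ×-dec e₀ ℕ.<? 5 ×-dec unique? A
    ×-dec all? (λ b → classOf b ℕ.≟ e₀ ×-dec classOf (b -F (g ^F c)) ℕ.≟ e₁ ×-dec classOf (b -F a) ℕ.≟ e₂) A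
    ×-dec all? (λ w′ → length (candidates (g ^F c) e₀ e₁ e₂ w′) ℕ.<? length A) (images (g ^F c) a)
    where
    open Witness w
    open import Data.List.Relation.Unary.Unique.DecPropositional _≟F_ using (unique?)

  module _ (valid : ValidTables) where
    open ValidTables valid

    ind⁻¹≢0F : ∀ {i} → i < N → ind⁻¹ i ≢ 0F
    ind⁻¹≢0F i<N = proj₁ (All.lookup ind-ind⁻¹ (∈-upTo⁺ i<N))

    ind∘ind⁻¹ : ∀ {i} → i < N → ind (ind⁻¹ i) ≡ i
    ind∘ind⁻¹ i<N = proj₂ (All.lookup ind-ind⁻¹ (∈-upTo⁺ i<N))

    pow-ind⁻¹ : ∀ n → g ^F n ≡ ind⁻¹ (n % N)
    pow-ind⁻¹ zero    = trans (sym ind⁻¹-0) (cong ind⁻¹ (sym (m<n⇒m%n≡m (>-nonZero⁻¹ N))))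
    pow-ind⁻¹ (suc n) = begin
      g *F (g ^F n)            ≡⟨ cong (g *F_) (pow-ind⁻¹ n) ⟩
      g *F ind⁻¹ (n % N)       ≡⟨ All.lookup ind⁻¹-suc (∈-upTo⁺ (m%n<n n N)) ⟩
      ind⁻¹ (suc (n % N) % N)  ≡⟨ cong ind⁻¹ ([m+n%d]%d≡[m+n]%d N 1 n) ⟩
      ind⁻¹ (suc n % N)        ∎
      where open ≡-Reasoning

    ind⁻¹∘ind : ∀ {x} → x ≢ 0F → ind x < N × ind⁻¹ (ind x) ≡ x
    ind⁻¹∘ind {x} x≢0F with All.lookup ind⁻¹-ind (∈-vectors ∈-allFin x)
    ... | inj₁ x≡0F = contradiction x≡0F x≢0F
    ... | inj₂ prf  = prf

    pow-ind : ∀ {x} → x ≢ 0F → g ^F ind x ≡ x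
    pow-ind {x} x≢0F = begin
      g ^F ind x         ≡⟨ pow-ind⁻¹ (ind x) ⟩
      ind⁻¹ (ind x % N)  ≡⟨ cong ind⁻¹ (m<n⇒m%n≡m (proj₁ (ind⁻¹∘ind x≢0F))) ⟩
      ind⁻¹ (ind x)      ≡⟨ proj₂ (ind⁻¹∘ind x≢0F) ⟩
      x                  ∎
      where open ≡-Reasoning

    pow≢0F : ∀ n → g ^F n ≢ 0F
    pow≢0F n gⁿ≡0F = ind⁻¹≢0F (m%n<n n N) (trans (sym (pow-ind⁻¹ n)) gⁿ≡0F)

    pow-+ : ∀ a b → (g ^F a) *F (g ^F b) ≡ g ^F (a + b)
    pow-+ zero    b = *F-identityˡ (g ^F b)
    pow-+ (suc a) b = trans (*F-assoc-onBasis g assoc-onBasis (g ^F a) (g ^F b)) (cong (g *F_) (pow-+ a b))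

    classOf-0F : classOf 0F ≡ 5
    classOf-0F = cong (if_then 5 else ind 0F % 5) (dec-true (0F ≟F 0F) refl)

    classOf-≢0F : ∀ {x} → x ≢ 0F → classOf x ≡ ind x % 5
    classOf-≢0F {x} x≢0F = cong (if_then 5 else ind x % 5) (dec-false (x ≟F 0F) x≢0F)

    classOf<5 : ∀ {x} → x ≢ 0F → classOf x < 5
    classOf<5 {x} x≢0F = subst (_< 5) (sym (classOf-≢0F x≢0F)) (m%n<n (ind x) 5)

    classOf<5⇒≢0F : ∀ {x} → classOf x < 5 → x ≢ 0F
    classOf<5⇒≢0F {x} cx<5 x≡0F = <-irrefl (trans (cong classOf x≡0F) classOf-0F) cx<5

    classOf-pow : ∀ n → classOf (g ^F n) ≡ n % 5
    classOf-pow n = begin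
      classOf (g ^F n)         ≡⟨ classOf-≢0F (pow≢0F n) ⟩
      ind (g ^F n) % 5         ≡⟨ cong (λ x → ind x % 5) (pow-ind⁻¹ n) ⟩
      ind (ind⁻¹ (n % N)) % 5  ≡⟨ cong (_% 5) (ind∘ind⁻¹ (m%n<n n N)) ⟩
      n % N % 5                ≡⟨ m∣n⇒o%n%m≡o%m 5 N n (m∣m*n M) ⟩
      n % 5                    ∎
      where open ≡-Reasoning

    ∈-classMembers : ∀ {k y} → k < 5 → classOf y ≡ k → y ∈ classMembers k
    ∈-classMembers {k} {y} k<5 cy≡k = subst (_∈ classMembers k) ind⁻¹-j (∈-map⁺ _ (∈-upTo⁺ j<M))
      where
      y≢0F : y ≢ 0F
      y≢0F = classOf<5⇒≢0F (subst (_< 5) (sym cy≡k) k<5)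

      j = ind y / 5

      j<M : j < M
      j<M = m<n*o⇒m/o<n (subst (ind y <_) (*-comm 5 M) (proj₁ (ind⁻¹∘ind y≢0F)))

      ind-y : 5 * j + k ≡ ind y
      ind-y = begin
        5 * j + k          ≡⟨ +-comm (5 * j) k ⟩
        k + 5 * j          ≡⟨ cong₂ _+_ (trans (sym (classOf-≢0F y≢0F)) cy≡k) (*-comm j 5) ⟨
        ind y % 5 + j * 5  ≡⟨ m≡m%n+[m/n]*n (ind y) 5 ⟨
        ind y              ∎
        where open ≡-Reasoning

      ind⁻¹-j : ind⁻¹ (5 * j + k) ≡ y
      ind⁻¹-j = trans (cong ind⁻¹ ind-y) (proj₂ (ind⁻¹∘ind y≢0F))

    classOf≡5⇒≡0F : ∀ {x} → classOf x ≡ 5 → x ≡ 0F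
    classOf≡5⇒≡0F {x} cx≡5 = decidable-stable (x ≟F 0F) λ x≢0F → <⇒≢ (classOf<5 x≢0F) cx≡5

    classOf-pow5* : ∀ k w → classOf ((g ^F (5 * k)) *F w) ≡ classOf w
    classOf-pow5* k w = case w ≟F 0F of λ where
        (yes refl) → cong classOf (linear-0ᴹ (horner-linearʳ (g ^F (5 * k))))
        (no w≢0F)  → nonzero w≢0F
      where
      open ≡-Reasoning

      nonzero : w ≢ 0F → classOf ((g ^F (5 * k)) *F w) ≡ classOf w
      nonzero w≢0F = begin
        classOf ((g ^F (5 * k)) *F w)             ≡⟨ cong (λ x → classOf ((g ^F (5 * k)) *F x)) (pow-ind w≢0F) ⟨
        classOf ((g ^F (5 * k)) *F (g ^F ind w))  ≡⟨ cong classOf (pow-+ (5 * k) (ind w)) ⟩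
        classOf (g ^F (5 * k + ind w))            ≡⟨ classOf-pow (5 * k + ind w) ⟩
        (5 * k + ind w) % 5                       ≡⟨ cong (_% 5) (trans (+-comm (5 * k) (ind w)) (cong (ind w +_) (*-comm 5 k))) ⟩
        (ind w + k * 5) % 5                       ≡⟨ [m+kn]%n≡m%n (ind w) k 5 ⟩
        ind w % 5                                 ≡⟨ classOf-≢0F w≢0F ⟨
        classOf w                                 ∎

    classOf-x-Fx : ∀ x → classOf (x -F x) ≡ 5
    classOf-x-Fx x = trans (cong classOf (x-Fx≡0F x)) classOf-0F

    swapsClasses-injective : ∀ {σ} → SwapsClasses σ → ∀ {x y} → σ x ≡ σ y → x ≡ y
    swapsClasses-injective {σ} swaps {x} {y} σx≡σy = -F≡0F⇒≡ (classOf≡5⇒≡0F (swap01≡5⇒≡5 (begin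
      swap01 (classOf (x -F y))  ≡⟨ swaps x y ⟨
      classOf (σ x -F σ y)       ≡⟨ cong (λ z → classOf (σ x -F z)) σx≡σy ⟨
      classOf (σ x -F σ x)       ≡⟨ classOf-x-Fx (σ x) ⟩
      5                          ∎)))
      where open ≡-Reasoning

    module _ {ω : F} (ω-primitive : PrimitiveRoot ω) where

      ω≢0F : ω ≢ 0F
      ω≢0F ω≡0F with ω-primitive (g ^F 1) (pow≢0F 1)
      ... | zero  , ω⁰≡g¹ = 0≢1+n (trans (sym (classOf-pow 0)) (trans (cong classOf ω⁰≡g¹) (classOf-pow 1)))
      ... | suc k , ωᵏ⁺¹≡g¹ = pow≢0F 1 (begin
        g ^F 1              ≡⟨ ωᵏ⁺¹≡g¹ ⟨
        ω *F (ω ^F k)       ≡⟨ cong (_*F (ω ^F k)) ω≡0F ⟩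
        0F *F (ω ^F k)      ≡⟨ *F-zeroˡ (ω ^F k) ⟩
        0F                  ∎)
        where open ≡-Reasoning

      d : ℕ
      d = ind ω

      ω^F≡g^F : ∀ n → ω ^F n ≡ g ^F (n * d)
      ω^F≡g^F zero    = refl
      ω^F≡g^F (suc n) = trans (cong₂ _*F_ (sym (pow-ind ω≢0F)) (ω^F≡g^F n)) (pow-+ d (n * d))

      classOf-ω^ : ∀ n → classOf (ω ^F n) ≡ (n * (d % 5)) % 5
      classOf-ω^ n = begin
        classOf (ω ^F n)        ≡⟨ cong classOf (ω^F≡g^F n) ⟩
        classOf (g ^F (n * d))  ≡⟨ classOf-pow (n * d) ⟩
        (n * d) % 5             ≡⟨ [m*n%d]%d≡[m*n]%d 5 n d ⟨
        (n * (d % 5)) % 5       ∎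
        where open ≡-Reasoning

      d%5≢0 : d % 5 ≢ 0
      d%5≢0 d%5≡0 with ω-primitive (g ^F 1) (pow≢0F 1)
      ... | k , ωᵏ≡g¹ = 0≢1+n (begin
        0                   ≡⟨ cong (_% 5) (*-zeroʳ k) ⟨
        (k * 0) % 5         ≡⟨ cong (λ r → (k * r) % 5) d%5≡0 ⟨
        (k * (d % 5)) % 5   ≡⟨ classOf-ω^ k ⟨
        classOf (ω ^F k)    ≡⟨ cong classOf ωᵏ≡g¹ ⟩
        classOf (g ^F 1)    ≡⟨ classOf-pow 1 ⟩
        1                   ∎)
        where open ≡-Reasoning

      hasColour⇒classOf : ∀ {x y i} → HasColour ω x y i → classOf (x -F y) ≡ (toℕ i * (d % 5)) % 5
      hasColour⇒classOf {x} {y} {i} (k , x-y≡ωⁿ) = begin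
        classOf (x -F y)                         ≡⟨ cong classOf x-y≡ωⁿ ⟩
        classOf (ω ^F (5 * k + toℕ i))           ≡⟨ classOf-ω^ (5 * k + toℕ i) ⟩
        ((5 * k + toℕ i) * (d % 5)) % 5          ≡⟨ cong (_% 5) (rearrange k (toℕ i) (d % 5)) ⟩
        (toℕ i * (d % 5) + k * (d % 5) * 5) % 5  ≡⟨ [m+kn]%n≡m%n (toℕ i * (d % 5)) (k * (d % 5)) 5 ⟩
        (toℕ i * (d % 5)) % 5                    ∎
        where
        open ≡-Reasoning
        open +-*-Solver using (solve; _:+_; _:*_; _:=_; con)

        rearrange : ∀ k j s → (5 * k + j) * s ≡ j * s + k * s * 5
        rearrange = solve 3 (λ k j s → (con 5 :* k :+ j) :* s := j :* s :+ k :* s :* con 5) refl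

      hasSomeColour : ∀ {x y} → x ≢ y → ∃ (HasColour ω x y)
      hasSomeColour {x} {y} x≢y with ω-primitive (x -F y) (x≢y ∘ -F≡0F⇒≡)
      ... | n , ωⁿ≡x-y = n mod 5 , n / 5 , trans (sym ωⁿ≡x-y) (cong (ω ^F_) n≡)
        where
        n≡ : n ≡ 5 * (n / 5) + toℕ (n mod 5)
        n≡ = begin
          n                            ≡⟨ m≡m%n+[m/n]*n n 5 ⟩
          n % 5 + n / 5 * 5            ≡⟨ +-comm (n % 5) (n / 5 * 5) ⟩
          n / 5 * 5 + n % 5            ≡⟨ cong₂ _+_ (*-comm (n / 5) 5) (sym (toℕ-fromℕ< (m%n<n n 5))) ⟩
          5 * (n / 5) + toℕ (n mod 5)  ∎
          where open ≡-Reasoning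

      colourSymmetric⇒swapsClasses : ColourSymmetric ω → ∃ SwapsClasses
      colourSymmetric⇒swapsClasses colourSymmetric = Inverse.to σ , swaps
        where
        t : Fin 5
        t = d mod 5

        toℕ-t : toℕ t ≡ d % 5
        toℕ-t = toℕ-fromℕ< (m%n<n d 5)

        t≢0 : t ≢ Fin.zero
        t≢0 t≡0 = d%5≢0 (trans (sym toℕ-t) (cong toℕ t≡0))

        σ = proj₁ (colourSymmetric (classSwap↔ t t≢0))
        induces = proj₂ (colourSymmetric (classSwap↔ t t≢0))

        classOf-colour : ∀ {x y i} → HasColour ω x y i → classOf (x -F y) ≡ (toℕ i * toℕ t) % 5
        classOf-colour {i = i} c = trans (hasColour⇒classOf c) (cong (λ z → (toℕ i * z) % 5) (sym toℕ-t))

        swaps : SwapsClasses (Inverse.to σ)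
        swaps x y = case x ≟F y of λ where
            (yes refl) → trans (classOf-x-Fx (Inverse.to σ x)) (cong swap01 (sym (classOf-x-Fx x)))
            (no x≢y)   → coloured (proj₂ (hasSomeColour x≢y)) x≢y
          where
          open ≡-Reasoning

          coloured : ∀ {i} → HasColour ω x y i → x ≢ y →
                     classOf (Inverse.to σ x -F Inverse.to σ y) ≡ swap01 (classOf (x -F y))
          coloured {i} c x≢y = begin
            classOf (Inverse.to σ x -F Inverse.to σ y)  ≡⟨ classOf-colour (induces x y i x≢y c) ⟩
            (toℕ (classSwap t i) * toℕ t) % 5           ≡⟨ classSwap-conjugates t t≢0 i ⟩
            swap01 ((toℕ i * toℕ t) % 5)                ≡⟨ cong swap01 (classOf-colour c) ⟨
            swap01 (classOf (x -F y))                   ∎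

    pow-periodic : ∀ n → g ^F (n + N) ≡ g ^F n
    pow-periodic n = trans (pow-ind⁻¹ (n + N)) (trans (cong ind⁻¹ ([m+n]%n≡m%n n N)) (sym (pow-ind⁻¹ n)))

    ∃pow5*≡pow : ∀ {v c} → v ≢ 0F → classOf v ≡ c → ∃ λ k → (g ^F (5 * k)) *F v ≡ g ^F c
    ∃pow5*≡pow {v} {c} v≢0F classOf-v = M ∸ q , (begin
      (g ^F (5 * (M ∸ q))) *F v              ≡⟨ cong ((g ^F (5 * (M ∸ q))) *F_) (pow-ind v≢0F) ⟨
      (g ^F (5 * (M ∸ q))) *F (g ^F ind v)   ≡⟨ pow-+ (5 * (M ∸ q)) (ind v) ⟩
      g ^F (5 * (M ∸ q) + ind v)             ≡⟨ cong (g ^F_) exponent ⟩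
      g ^F (c + N)                           ≡⟨ pow-periodic c ⟩
      g ^F c                                 ∎)
      where
      open ≡-Reasoning
      q = ind v / 5

      q≤M : q ≤ M
      q≤M = <⇒≤ (m<n*o⇒m/o<n (subst (ind v <_) (*-comm 5 M) (proj₁ (ind⁻¹∘ind v≢0F))))

      ind-v : ind v ≡ c + 5 * q
      ind-v = trans (m≡m%n+[m/n]*n (ind v) 5)
                    (cong₂ _+_ (trans (sym (classOf-≢0F v≢0F)) classOf-v) (*-comm q 5))

      exponent : 5 * (M ∸ q) + ind v ≡ c + N
      exponent = begin
        5 * (M ∸ q) + ind v        ≡⟨ cong (5 * (M ∸ q) +_) ind-v ⟩
        5 * (M ∸ q) + (c + 5 * q)  ≡⟨ x∙yz≈y∙xz (5 * (M ∸ q)) c (5 * q) ⟩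
        c + (5 * (M ∸ q) + 5 * q)  ≡⟨ cong (c +_) (*-distribˡ-+ 5 (M ∸ q) q) ⟨
        c + 5 * (M ∸ q + q)        ≡⟨ cong (λ z → c + 5 * z) (m∸n+n≡m q≤M) ⟩
        c + N                      ∎
        where open import Algebra.Properties.CommutativeSemigroup +-commutativeSemigroup using (x∙yz≈y∙xz)

    normalise : ∀ {σ} → SwapsClasses σ → ∀ {c} → c < 5 → swap01 c ≡ c → ∃ λ σ′ → Normalised σ′ (g ^F c)
    normalise {σ} swaps {c} c<5 swap01-c = σ′ , record
      { swapsClasses = swaps′ ; fixes-0F = fixes-0F ; fixes-r = proj₂ (∃pow5*≡pow v≢0F classOf-v) }
      where
      open ≡-Reasoning
      r = g ^F c
      t₀ = σ 0F
      v = σ r -F t₀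

      classOf-v : classOf v ≡ c
      classOf-v = begin
        classOf v                   ≡⟨ swaps r 0F ⟩
        swap01 (classOf (r -F 0F))  ≡⟨ cong (swap01 ∘ classOf) (x-F0F≡x r) ⟩
        swap01 (classOf r)          ≡⟨ cong swap01 (trans (classOf-pow c) (m<n⇒m%n≡m c<5)) ⟩
        swap01 c                    ≡⟨ swap01-c ⟩
        c                           ∎

      v≢0F : v ≢ 0F
      v≢0F = classOf<5⇒≢0F (subst (_< 5) (sym classOf-v) c<5)

      k = proj₁ (∃pow5*≡pow v≢0F classOf-v)
      h = g ^F (5 * k)

      σ′ : F → F
      σ′ x = h *F (σ x -F t₀)

      fixes-0F : σ′ 0F ≡ 0F
      fixes-0F = trans (cong (h *F_) (x-Fx≡0F t₀)) (linear-0ᴹ (horner-linearʳ h))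

      swaps′ : SwapsClasses σ′
      swaps′ x y = begin
        classOf (σ′ x -F σ′ y)                       ≡⟨ cong classOf (linear-sub (horner-linearʳ h) _ _) ⟨
        classOf (h *F ((σ x -F t₀) -F (σ y -F t₀)))  ≡⟨ cong (λ z → classOf (h *F z)) ([x-Fz]-F[y-Fz]≡x-Fy (σ x) (σ y) t₀) ⟩
        classOf (h *F (σ x -F σ y))                  ≡⟨ classOf-pow5* k (σ x -F σ y) ⟩
        classOf (σ x -F σ y)                         ≡⟨ swaps x y ⟩
        swap01 (classOf (x -F y))                    ∎

    module _ {σ r} (normalised : Normalised σ r) where
      open Normalised normalised

      classOf-σ : ∀ x → classOf (σ x) ≡ swap01 (classOf x)
      classOf-σ x = begin
        classOf (σ x)               ≡⟨ cong classOf (x-F0F≡x (σ x)) ⟨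
        classOf (σ x -F 0F)         ≡⟨ cong (λ z → classOf (σ x -F z)) fixes-0F ⟨
        classOf (σ x -F σ 0F)       ≡⟨ swapsClasses x 0F ⟩
        swap01 (classOf (x -F 0F))  ≡⟨ cong (swap01 ∘ classOf) (x-F0F≡x x) ⟩
        swap01 (classOf x)          ∎
        where open ≡-Reasoning

      classOf-σ-r : ∀ x → classOf (σ x -F r) ≡ swap01 (classOf (x -F r))
      classOf-σ-r x = trans (cong (λ z → classOf (σ x -F z)) (sym fixes-r)) (swapsClasses x r)

      σ∈images : ∀ {a} → a ≢ 0F → σ a ∈ images r a
      σ∈images {a} a≢0F = ∈-filter⁺ _ (∈-classMembers (swap01<5 (classOf<5 a≢0F)) (classOf-σ a)) (classOf-σ-r a)

      σ∈candidates : ∀ {a e₀ e₁ e₂ b} → e₀ < 5 → Profile r a e₀ e₁ e₂ b → σ b ∈ candidates r e₀ e₁ e₂ (σ a)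
      σ∈candidates {a} {b = b} e₀<5 (cb , cbr , cba) =
        ∈-filter⁺ _ (∈-classMembers (swap01<5 e₀<5) (trans (classOf-σ b) (cong swap01 cb)))
                    (trans (classOf-σ-r b) (cong swap01 cbr) , trans (swapsClasses b a) (cong swap01 cba))

      length≤candidates : ∀ {a e₀ e₁ e₂ A} → e₀ < 5 → Unique A → All (Profile r a e₀ e₁ e₂) A →
                          length A ≤ length (candidates r e₀ e₁ e₂ (σ a))
      length≤candidates {A = A} e₀<5 uniq profiles =
        subst (_≤ _) (length-map σ A)
              (Unique-⊆⇒length≤ (Unique.map⁺ (swapsClasses-injective swapsClasses) uniq) σA⊆candidates)
        where
        σA⊆candidates : List.map σ A ⊆ _
        σA⊆candidates y∈σA with ∈-map⁻ σ y∈σA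
        ... | b , b∈A , refl = σ∈candidates e₀<5 (All.lookup profiles b∈A)

    refutes⇒∄swapsClasses : ∀ w → Refutes w → ¬ ∃ SwapsClasses
    refutes⇒∄swapsClasses w (c<5 , swap01-c , a≢0F , e₀<5 , uniq , profiles , bounded) (σ , swaps) =
      <⇒≱ (All.lookup bounded (σ∈images normalised a≢0F)) (length≤candidates normalised e₀<5 uniq profiles)
      where normalised = proj₂ (normalise {σ} swaps c<5 swap01-c)

    -- Colour symmetry alone is refuted.
    refutes⇒¬totallySymmetric : ∀ w → Refutes w → ∀ ω → PrimitiveRoot ω → ¬ TotallySymmetric ω
    refutes⇒¬totallySymmetric w refutes ω ω-primitive (_ , colourSymmetric) =
      refutes⇒∄swapsClasses w refutes (colourSymmetric⇒swapsClasses ω-primitive colourSymmetric)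

module F81 where

  antilog : Trie 3 4
  antilog = ((((1 ∷ 48 ∷ 12 ∷ []) ∷ (39 ∷ 79 ∷ 62 ∷ []) ∷ (33 ∷ 15 ∷ 64 ∷ []) ∷ []) ∷ ((27 ∷ 76 ∷ 19 ∷ []) ∷ (55 ∷ 56 ∷ 23 ∷ []) ∷ (68 ∷ 26 ∷ 66 ∷ []) ∷ []) ∷ ((63 ∷ 58 ∷ 42 ∷ []) ∷ (72 ∷ 18 ∷ 67 ∷ []) ∷ (10 ∷ 65 ∷ 37 ∷ []) ∷ []) ∷ []) ∷ (((3 ∷ 70 ∷ 36 ∷ []) ∷ (43 ∷ 80 ∷ 20 ∷ []) ∷ (25 ∷ 45 ∷ 35 ∷ []) ∷ []) ∷ ((7 ∷ 71 ∷ 57 ∷ []) ∷ (8 ∷ 2 ∷ 69 ∷ []) ∷ (38 ∷ 78 ∷ 41 ∷ []) ∷ []) ∷ ((32 ∷ 17 ∷ 52 ∷ []) ∷ (59 ∷ 54 ∷ 44 ∷ []) ∷ (30 ∷ 29 ∷ 28 ∷ []) ∷ []) ∷ []) ∷ (((9 ∷ 53 ∷ 34 ∷ []) ∷ (46 ∷ 74 ∷ 60 ∷ []) ∷ (75 ∷ 61 ∷ 22 ∷ []) ∷ []) ∷ ((21 ∷ 47 ∷ 14 ∷ []) ∷ (24 ∷ 6 ∷ 50 ∷ []) ∷ (31 ∷ 77 ∷ 40 ∷ []) ∷ []) ∷ ((13 ∷ 51 ∷ 73 ∷ []) ∷ (11 ∷ 5 ∷ 49 ∷ []) ∷ (16 ∷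 4 ∷ 0 ∷ []) ∷ []) ∷ []) ∷ [])

  log : Trie 3 4
  log = ((((0 ∷ 3 ∷ 43 ∷ []) ∷ (2 ∷ 55 ∷ 6 ∷ []) ∷ (42 ∷ 46 ∷ 15 ∷ []) ∷ []) ∷ ((1 ∷ 25 ∷ 58 ∷ []) ∷ (54 ∷ 9 ∷ 75 ∷ []) ∷ (5 ∷ 27 ∷ 20 ∷ []) ∷ []) ∷ ((41 ∷ 18 ∷ 65 ∷ []) ∷ (45 ∷ 60 ∷ 67 ∷ []) ∷ (14 ∷ 35 ∷ 49 ∷ []) ∷ []) ∷ []) ∷ (((0 ∷ 79 ∷ 12 ∷ []) ∷ (24 ∷ 78 ∷ 72 ∷ []) ∷ (57 ∷ 11 ∷ 62 ∷ []) ∷ []) ∷ ((53 ∷ 23 ∷ 33 ∷ []) ∷ (8 ∷ 77 ∷ 69 ∷ []) ∷ (74 ∷ 71 ∷ 30 ∷ []) ∷ []) ∷ ((4 ∷ 56 ∷ 47 ∷ []) ∷ (26 ∷ 10 ∷ 28 ∷ []) ∷ (19 ∷ 61 ∷ 36 ∷ []) ∷ []) ∷ []) ∷ (((40 ∷ 52 ∷ 39 ∷ []) ∷ (17 ∷ 22 ∷ 51 ∷ []) ∷ (64 ∷ 32 ∷ 38 ∷ []) ∷ []) ∷ ((44 ∷ 7 ∷ 16 ∷ []) ∷ (59 ∷ 76 ∷ 21 ∷ []) ∷ (66 ∷ 68 ∷ 50 ∷ []) ∷ []) ∷ ((13 ∷ 73 ∷ 63 ∷ []) ∷ (34 ∷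 70 ∷ 31 ∷ []) ∷ (48 ∷ 29 ∷ 37 ∷ []) ∷ []) ∷ []) ∷ [])

  open CyclotomicClasses 3 3 (# 2 ∷ # 1 ∷ # 0 ∷ # 0 ∷ []) (digits 3 4 3) 16 antilog log

  witness : Witness
  witness = record
    { c = 4 ; a = digits 3 4 33 ; e₀ = 1 ; e₁ = 3 ; e₂ = 0
    ; A = List.map (digits 3 4) (45 ∷ 3 ∷ 34 ∷ 68 ∷ []) }

  notTotallySymmetric : ∀ ω → GF81.PrimitiveRoot ω → ¬ GF81.TotallySymmetric ω
  notTotallySymmetric = refutes⇒¬totallySymmetric (toWitness {a? = validTables?} _)
                                                  witness (toWitness {a? = refutes? witness} _)

module F2401 where

  antilog : Trie 7 4
  antilog = ((((1 ∷ 418 ∷ 445 ∷ 176 ∷ 243 ∷ 904 ∷ 1126 ∷ []) ∷ (642 ∷ 2396 ∷ 547 ∷ 1586 ∷ 2277 ∷ 2113 ∷ 2006 ∷ []) ∷ (941 ∷ 2124 ∷ 1457 ∷ 1653 ∷ 718 ∷ 976 ∷ 1482 ∷ []) ∷ (1223 ∷ 1421 ∷ 1884 ∷ 1986 ∷ 520 ∷ 1897 ∷ 2217 ∷ []) ∷ (1415 ∷ 911 ∷ 1594 ∷ 419 ∷ 856 ∷ 621 ∷ 27 ∷ []) ∷ (1672 ∷ 1797 ∷ 1587 ∷ 287 ∷ 150 ∷ 1790 ∷ 1119 ∷ []) ∷ (568 ∷ 295 ∷ 1952 ∷ 664 ∷ 1131 ∷ 660 ∷ 2322 ∷ []) ∷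 []) ∷ ((2380 ∷ 1526 ∷ 1741 ∷ 196 ∷ 1858 ∷ 265 ∷ 898 ∷ []) ∷ (2214 ∷ 597 ∷ 463 ∷ 102 ∷ 1285 ∷ 1384 ∷ 369 ∷ []) ∷ (1545 ∷ 1946 ∷ 732 ∷ 1569 ∷ 444 ∷ 2166 ∷ 2199 ∷ []) ∷ (1390 ∷ 475 ∷ 2240 ∷ 1108 ∷ 255 ∷ 1983 ∷ 1730 ∷ []) ∷ (1558 ∷ 2177 ∷ 2000 ∷ 1162 ∷ 866 ∷ 1937 ∷ 2054 ∷ []) ∷ (417 ∷ 83 ∷ 2139 ∷ 67 ∷ 717 ∷ 565 ∷ 1037 ∷ []) ∷ (1761 ∷ 951 ∷ 1039 ∷ 698 ∷ 228 ∷ 2301 ∷ 2013 ∷ []) ∷ []) ∷ ((2044 ∷ 408 ∷ 1530 ∷ 893 ∷ 1619 ∷ 1722 ∷ 40 ∷ []) ∷ (519 ∷ 1486 ∷ 1772 ∷ 1661 ∷ 1597 ∷ 1735 ∷ 146 ∷ []) ∷ (564 ∷ 1018 ∷ 2224 ∷ 1913 ∷ 2154 ∷ 1120 ∷ 124 ∷ []) ∷ (2002 ∷ 2067 ∷ 2063 ∷ 378 ∷ 1000 ∷ 2298 ∷ 871 ∷ []) ∷ (307 ∷ 1640 ∷ 487 ∷ 2060 ∷ 1938 ∷ 2073 ∷ 2169 ∷ []) ∷ (1939 ∷ 558 ∷ 912 ∷ 2005 ∷ 857 ∷ 983 ∷ 465 ∷ []) ∷ (784 ∷ 216 ∷ 2089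 ∷ 1183 ∷ 442 ∷ 1386 ∷ 1659 ∷ []) ∷ []) ∷ ((1097 ∷ 461 ∷ 1598 ∷ 2146 ∷ 584 ∷ 1374 ∷ 1454 ∷ []) ∷ (668 ∷ 457 ∷ 45 ∷ 723 ∷ 671 ∷ 1648 ∷ 1366 ∷ []) ∷ (1053 ∷ 1683 ∷ 1591 ∷ 1972 ∷ 2279 ∷ 534 ∷ 145 ∷ []) ∷ (1923 ∷ 1069 ∷ 361 ∷ 1093 ∷ 1645 ∷ 175 ∷ 2226 ∷ []) ∷ (1239 ∷ 1833 ∷ 2223 ∷ 1551 ∷ 2052 ∷ 1294 ∷ 273 ∷ []) ∷ (1157 ∷ 1171 ∷ 1764 ∷ 782 ∷ 453 ∷ 719 ∷ 1338 ∷ []) ∷ (1359 ∷ 685 ∷ 2290 ∷ 335 ∷ 530 ∷ 812 ∷ 1500 ∷ []) ∷ []) ∷ ((159 ∷ 679 ∷ 258 ∷ 430 ∷ 657 ∷ 1006 ∷ 2355 ∷ []) ∷ (1406 ∷ 1890 ∷ 1749 ∷ 739 ∷ 559 ∷ 1274 ∷ 2100 ∷ []) ∷ (1468 ∷ 937 ∷ 397 ∷ 1729 ∷ 508 ∷ 2035 ∷ 1387 ∷ []) ∷ (643 ∷ 14 ∷ 992 ∷ 1419 ∷ 2121 ∷ 609 ∷ 675 ∷ []) ∷ (1233 ∷ 1727 ∷ 2004 ∷ 446 ∷ 545 ∷ 681 ∷ 688 ∷ []) ∷ (1765 ∷ 1144 ∷ 891 ∷ 846 ∷ 1189 ∷ 80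 ∷ 1291 ∷ []) ∷ (188 ∷ 2332 ∷ 734 ∷ 2398 ∷ 1327 ∷ 2126 ∷ 2237 ∷ []) ∷ []) ∷ ((2202 ∷ 1919 ∷ 2211 ∷ 1682 ∷ 1180 ∷ 1527 ∷ 2152 ∷ []) ∷ (555 ∷ 2122 ∷ 1027 ∷ 770 ∷ 758 ∷ 889 ∷ 66 ∷ []) ∷ (1391 ∷ 837 ∷ 284 ∷ 1235 ∷ 99 ∷ 143 ∷ 399 ∷ []) ∷ (1850 ∷ 1780 ∷ 2204 ∷ 298 ∷ 343 ∷ 1642 ∷ 1260 ∷ []) ∷ (1351 ∷ 2200 ∷ 1146 ∷ 1671 ∷ 1379 ∷ 1142 ∷ 118 ∷ []) ∷ (527 ∷ 2372 ∷ 522 ∷ 276 ∷ 356 ∷ 1405 ∷ 1479 ∷ []) ∷ (491 ∷ 202 ∷ 1447 ∷ 2221 ∷ 771 ∷ 1169 ∷ 1334 ∷ []) ∷ []) ∷ ((1678 ∷ 1903 ∷ 1848 ∷ 1350 ∷ 1664 ∷ 44 ∷ 655 ∷ []) ∷ (2312 ∷ 322 ∷ 424 ∷ 551 ∷ 395 ∷ 1299 ∷ 2369 ∷ []) ∷ (1589 ∷ 1192 ∷ 1396 ∷ 574 ∷ 58 ∷ 2164 ∷ 1377 ∷ []) ∷ (2171 ∷ 1894 ∷ 901 ∷ 2162 ∷ 472 ∷ 1056 ∷ 130 ∷ []) ∷ (691 ∷ 2112 ∷ 1595 ∷ 830 ∷ 1301 ∷ 405 ∷ 214 ∷ []) ∷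 (2174 ∷ 684 ∷ 1879 ∷ 2291 ∷ 354 ∷ 968 ∷ 939 ∷ []) ∷ (1917 ∷ 1306 ∷ 142 ∷ 37 ∷ 187 ∷ 1921 ∷ 632 ∷ []) ∷ []) ∷ []) ∷ (((2107 ∷ 2368 ∷ 1713 ∷ 1254 ∷ 485 ∷ 1630 ∷ 1055 ∷ []) ∷ (1268 ∷ 1078 ∷ 592 ∷ 775 ∷ 328 ∷ 13 ∷ 106 ∷ []) ∷ (94 ∷ 1933 ∷ 452 ∷ 644 ∷ 900 ∷ 1793 ∷ 34 ∷ []) ∷ (1445 ∷ 1448 ∷ 231 ∷ 1216 ∷ 1296 ∷ 1178 ∷ 754 ∷ []) ∷ (755 ∷ 1974 ∷ 832 ∷ 1731 ∷ 1281 ∷ 174 ∷ 1690 ∷ []) ∷ (1982 ∷ 1711 ∷ 481 ∷ 2346 ∷ 1670 ∷ 1360 ∷ 704 ∷ []) ∷ (1638 ∷ 2059 ∷ 1520 ∷ 1978 ∷ 2385 ∷ 753 ∷ 1201 ∷ []) ∷ []) ∷ ((1363 ∷ 1895 ∷ 1312 ∷ 199 ∷ 599 ∷ 1243 ∷ 985 ∷ []) ∷ (1979 ∷ 3 ∷ 1191 ∷ 1328 ∷ 136 ∷ 274 ∷ 2320 ∷ []) ∷ (777 ∷ 1226 ∷ 1602 ∷ 1298 ∷ 2007 ∷ 1637 ∷ 1523 ∷ []) ∷ (919 ∷ 2130 ∷ 1563 ∷ 1872 ∷ 1774 ∷ 2098 ∷ 2137 ∷ []) ∷ (1724 ∷ 813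 ∷ 1862 ∷ 458 ∷ 407 ∷ 1168 ∷ 448 ∷ []) ∷ (261 ∷ 1746 ∷ 2341 ∷ 1975 ∷ 1194 ∷ 2176 ∷ 1114 ∷ []) ∷ (209 ∷ 1915 ∷ 526 ∷ 2003 ∷ 77 ∷ 100 ∷ 505 ∷ []) ∷ []) ∷ ((1329 ∷ 498 ∷ 376 ∷ 2153 ∷ 709 ∷ 2080 ∷ 285 ∷ []) ∷ (1590 ∷ 1603 ∷ 1834 ∷ 358 ∷ 245 ∷ 667 ∷ 95 ∷ []) ∷ (69 ∷ 1497 ∷ 1105 ∷ 1340 ∷ 299 ∷ 761 ∷ 1737 ∷ []) ∷ (1625 ∷ 1828 ∷ 595 ∷ 2091 ∷ 1963 ∷ 1325 ∷ 1689 ∷ []) ∷ (940 ∷ 1762 ∷ 1362 ∷ 1477 ∷ 874 ∷ 72 ∷ 412 ∷ []) ∷ (924 ∷ 1825 ∷ 1680 ∷ 400 ∷ 987 ∷ 2192 ∷ 603 ∷ []) ∷ (824 ∷ 1195 ∷ 186 ∷ 1559 ∷ 194 ∷ 2095 ∷ 1289 ∷ []) ∷ []) ∷ ((337 ∷ 1428 ∷ 2352 ∷ 291 ∷ 1409 ∷ 805 ∷ 1326 ∷ []) ∷ (810 ∷ 546 ∷ 1224 ∷ 1839 ∷ 2329 ∷ 1770 ∷ 364 ∷ []) ∷ (1179 ∷ 1165 ∷ 2057 ∷ 514 ∷ 1798 ∷ 1998 ∷ 389 ∷ []) ∷ (466 ∷ 1293 ∷ 2263 ∷ 1513 ∷ 594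 ∷ 1548 ∷ 861 ∷ []) ∷ (1958 ∷ 420 ∷ 1399 ∷ 1373 ∷ 1036 ∷ 2300 ∷ 1651 ∷ []) ∷ (1920 ∷ 221 ∷ 1784 ∷ 1356 ∷ 1378 ∷ 606 ∷ 1417 ∷ []) ∷ (20 ∷ 623 ∷ 1317 ∷ 2344 ∷ 422 ∷ 2172 ∷ 2256 ∷ []) ∷ []) ∷ ((1090 ∷ 329 ∷ 892 ∷ 1257 ∷ 1627 ∷ 207 ∷ 1135 ∷ []) ∷ (984 ∷ 876 ∷ 1369 ∷ 2001 ∷ 1531 ∷ 1304 ∷ 1721 ∷ []) ∷ (2028 ∷ 1262 ∷ 1371 ∷ 30 ∷ 2071 ∷ 1264 ∷ 1801 ∷ []) ∷ (974 ∷ 702 ∷ 1955 ∷ 1980 ∷ 414 ∷ 1636 ∷ 1161 ∷ []) ∷ (1313 ∷ 610 ∷ 694 ∷ 1076 ∷ 878 ∷ 1799 ∷ 133 ∷ []) ∷ (1490 ∷ 973 ∷ 683 ∷ 1517 ∷ 1853 ∷ 570 ∷ 781 ∷ []) ∷ (2193 ∷ 1021 ∷ 1014 ∷ 490 ∷ 2234 ∷ 1345 ∷ 2094 ∷ []) ∷ []) ∷ ((641 ∷ 1985 ∷ 109 ∷ 1459 ∷ 2090 ∷ 1601 ∷ 887 ∷ []) ∷ (649 ∷ 120 ∷ 1253 ∷ 74 ∷ 1185 ∷ 1271 ∷ 2269 ∷ []) ∷ (625 ∷ 1754 ∷ 476 ∷ 382 ∷ 2210 ∷ 1320 ∷ 735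 ∷ []) ∷ (542 ∷ 1891 ∷ 2111 ∷ 1177 ∷ 385 ∷ 1174 ∷ 554 ∷ []) ∷ (306 ∷ 1229 ∷ 42 ∷ 2276 ∷ 1744 ∷ 1561 ∷ 1092 ∷ []) ∷ (1647 ∷ 955 ∷ 365 ∷ 426 ∷ 1324 ∷ 1278 ∷ 1259 ∷ []) ∷ (242 ∷ 493 ∷ 1024 ∷ 2330 ∷ 2181 ∷ 809 ∷ 184 ∷ []) ∷ []) ∷ ((226 ∷ 1472 ∷ 1130 ∷ 249 ∷ 1877 ∷ 1518 ∷ 2215 ∷ []) ∷ (1732 ∷ 1699 ∷ 612 ∷ 1474 ∷ 1959 ∷ 789 ∷ 1837 ∷ []) ∷ (244 ∷ 1322 ∷ 1564 ∷ 2283 ∷ 2212 ∷ 2225 ∷ 2324 ∷ []) ∷ (168 ∷ 1758 ∷ 2161 ∷ 61 ∷ 954 ∷ 297 ∷ 324 ∷ []) ∷ (1652 ∷ 650 ∷ 538 ∷ 1698 ∷ 201 ∷ 1029 ∷ 1783 ∷ []) ∷ (1687 ∷ 917 ∷ 1700 ∷ 1023 ∷ 1912 ∷ 1736 ∷ 1025 ∷ []) ∷ (2222 ∷ 1140 ∷ 1614 ∷ 1167 ∷ 86 ∷ 1054 ∷ 1751 ∷ []) ∷ []) ∷ []) ∷ (((2120 ∷ 2131 ∷ 1925 ∷ 2310 ∷ 1950 ∷ 2285 ∷ 591 ∷ []) ∷ (611 ∷ 1112 ∷ 1514 ∷ 1005 ∷ 1993 ∷ 988 ∷ 160 ∷ [])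 ∷ (1272 ∷ 286 ∷ 2015 ∷ 982 ∷ 54 ∷ 486 ∷ 2041 ∷ []) ∷ (1612 ∷ 387 ∷ 1947 ∷ 1094 ∷ 2014 ∷ 620 ∷ 2353 ∷ []) ∷ (1716 ∷ 277 ∷ 767 ∷ 1843 ∷ 1655 ∷ 1491 ∷ 1516 ∷ []) ∷ (334 ∷ 112 ∷ 374 ∷ 1667 ∷ 169 ∷ 2127 ∷ 198 ∷ []) ∷ (292 ∷ 1771 ∷ 1250 ∷ 1159 ∷ 1951 ∷ 246 ∷ 686 ∷ []) ∷ []) ∷ ((1245 ∷ 1464 ∷ 1778 ∷ 1375 ∷ 1816 ∷ 439 ∷ 1604 ∷ []) ∷ (865 ∷ 1519 ∷ 1616 ∷ 1940 ∷ 969 ∷ 1357 ∷ 1789 ∷ []) ∷ (425 ∷ 962 ∷ 833 ∷ 1083 ∷ 2213 ∷ 235 ∷ 25 ∷ []) ∷ (2031 ∷ 177 ∷ 605 ∷ 1349 ∷ 1246 ∷ 2350 ∷ 528 ∷ []) ∷ (1492 ∷ 1878 ∷ 1880 ∷ 252 ∷ 792 ∷ 752 ∷ 790 ∷ []) ∷ (18 ∷ 2251 ∷ 434 ∷ 2384 ∷ 391 ∷ 756 ∷ 116 ∷ []) ∷ (844 ∷ 409 ∷ 1941 ∷ 1331 ∷ 1452 ∷ 1916 ∷ 895 ∷ []) ∷ []) ∷ ((1646 ∷ 544 ∷ 270 ∷ 593 ∷ 1137 ∷ 423 ∷ 182 ∷ []) ∷ (2351 ∷ 890 ∷ 477 ∷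 744 ∷ 247 ∷ 1104 ∷ 978 ∷ []) ∷ (1044 ∷ 435 ∷ 2 ∷ 829 ∷ 883 ∷ 303 ∷ 87 ∷ []) ∷ (1697 ∷ 2233 ∷ 934 ∷ 1999 ∷ 751 ∷ 421 ∷ 1810 ∷ []) ∷ (388 ∷ 2316 ∷ 1539 ∷ 1847 ∷ 464 ∷ 513 ∷ 1380 ∷ []) ∷ (569 ∷ 370 ∷ 2390 ∷ 441 ∷ 1367 ∷ 1221 ∷ 991 ∷ []) ∷ (710 ∷ 97 ∷ 380 ∷ 1430 ∷ 437 ∷ 831 ∷ 1712 ∷ []) ∷ []) ∷ ((1757 ∷ 1792 ∷ 2360 ∷ 827 ∷ 110 ∷ 1821 ∷ 127 ∷ []) ∷ (8 ∷ 886 ∷ 1151 ∷ 1065 ∷ 1552 ∷ 2078 ∷ 1389 ∷ []) ∷ (326 ∷ 1977 ∷ 1967 ∷ 651 ∷ 1074 ∷ 49 ∷ 1266 ∷ []) ∷ (309 ∷ 193 ∷ 2027 ∷ 851 ∷ 926 ∷ 197 ∷ 2220 ∷ []) ∷ (2165 ∷ 1788 ∷ 682 ∷ 1099 ∷ 1408 ∷ 394 ∷ 888 ∷ []) ∷ (1691 ∷ 2134 ∷ 372 ∷ 894 ∷ 2030 ∷ 2167 ∷ 167 ∷ []) ∷ (1339 ∷ 2331 ∷ 659 ∷ 1953 ∷ 1200 ∷ 2275 ∷ 1676 ∷ []) ∷ []) ∷ ((2387 ∷ 2050 ∷ 46 ∷ 1085 ∷ 766 ∷ 1432 ∷ 1217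 ∷ []) ∷ (1898 ∷ 227 ∷ 1883 ∷ 1568 ∷ 82 ∷ 1728 ∷ 2366 ∷ []) ∷ (913 ∷ 2367 ∷ 1295 ∷ 816 ∷ 652 ∷ 1436 ∷ 494 ∷ []) ∷ (323 ∷ 786 ∷ 989 ∷ 571 ∷ 1143 ∷ 529 ∷ 401 ∷ []) ∷ (1484 ∷ 1342 ∷ 778 ∷ 1644 ∷ 2040 ∷ 1082 ∷ 1851 ∷ []) ∷ (84 ∷ 617 ∷ 1211 ∷ 1733 ∷ 1718 ∷ 707 ∷ 1650 ∷ []) ∷ (927 ∷ 615 ∷ 264 ∷ 536 ∷ 918 ∷ 1719 ∷ 1125 ∷ []) ∷ []) ∷ ((1562 ∷ 1510 ∷ 1679 ∷ 2265 ∷ 2293 ∷ 1127 ∷ 1508 ∷ []) ∷ (1570 ∷ 855 ∷ 203 ∷ 2326 ∷ 971 ∷ 1787 ∷ 271 ∷ []) ∷ (1400 ∷ 2259 ∷ 2187 ∷ 915 ∷ 403 ∷ 1835 ∷ 776 ∷ []) ∷ (1760 ∷ 582 ∷ 944 ∷ 914 ∷ 41 ∷ 1397 ∷ 943 ∷ []) ∷ (1234 ∷ 2138 ∷ 2106 ∷ 622 ∷ 438 ∷ 1193 ∷ 1807 ∷ []) ∷ (2064 ∷ 747 ∷ 1095 ∷ 2082 ∷ 715 ∷ 2186 ∷ 497 ∷ []) ∷ (779 ∷ 2055 ∷ 2135 ∷ 1258 ∷ 2038 ∷ 645 ∷ 1311 ∷ []) ∷ []) ∷ ((1008 ∷ 908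 ∷ 278 ∷ 1129 ∷ 2288 ∷ 1439 ∷ 1685 ∷ []) ∷ (1549 ∷ 1230 ∷ 411 ∷ 320 ∷ 1871 ∷ 1412 ∷ 1996 ∷ []) ∷ (191 ∷ 1247 ∷ 311 ∷ 966 ∷ 166 ∷ 811 ∷ 964 ∷ []) ∷ (1197 ∷ 1091 ∷ 355 ∷ 1330 ∷ 1041 ∷ 1471 ∷ 768 ∷ []) ∷ (938 ∷ 1276 ∷ 479 ∷ 1524 ∷ 787 ∷ 1057 ∷ 1009 ∷ []) ∷ (340 ∷ 218 ∷ 936 ∷ 28 ∷ 1634 ∷ 381 ∷ 1841 ∷ []) ∷ (2036 ∷ 1805 ∷ 2123 ∷ 1046 ∷ 1215 ∷ 885 ∷ 740 ∷ []) ∷ []) ∷ []) ∷ (((357 ∷ 2284 ∷ 229 ∷ 262 ∷ 2108 ∷ 35 ∷ 1808 ∷ []) ∷ (705 ∷ 353 ∷ 557 ∷ 501 ∷ 1567 ∷ 730 ∷ 796 ∷ []) ∷ (1493 ∷ 2289 ∷ 2318 ∷ 85 ∷ 986 ∷ 1656 ∷ 1909 ∷ []) ∷ (653 ∷ 1854 ∷ 932 ∷ 1219 ∷ 211 ∷ 468 ∷ 1723 ∷ []) ∷ (1435 ∷ 132 ∷ 948 ∷ 240 ∷ 2114 ∷ 141 ∷ 2370 ∷ []) ∷ (237 ∷ 798 ∷ 858 ∷ 1051 ∷ 903 ∷ 708 ∷ 2012 ∷ []) ∷ (533 ∷ 2128 ∷ 741 ∷ 1332 ∷ 1814 ∷ 2354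 ∷ 721 ∷ []) ∷ []) ∷ ((2252 ∷ 803 ∷ 78 ∷ 511 ∷ 950 ∷ 1020 ∷ 596 ∷ []) ∷ (701 ∷ 1544 ∷ 1535 ∷ 630 ∷ 1442 ∷ 600 ∷ 1654 ∷ []) ∷ (318 ∷ 1098 ∷ 872 ∷ 2043 ∷ 2273 ∷ 428 ∷ 2278 ∷ []) ∷ (39 ∷ 960 ∷ 60 ∷ 543 ∷ 2260 ∷ 148 ∷ 1353 ∷ []) ∷ (2248 ∷ 1994 ∷ 1063 ∷ 598 ∷ 881 ∷ 540 ∷ 1118 ∷ []) ∷ (1927 ∷ 346 ∷ 89 ∷ 2245 ∷ 678 ∷ 1773 ∷ 2023 ∷ []) ∷ (2105 ∷ 204 ∷ 336 ∷ 1066 ∷ 1914 ∷ 115 ∷ 1565 ∷ []) ∷ []) ∷ ((300 ∷ 1172 ∷ 2182 ∷ 1220 ∷ 629 ∷ 906 ∷ 1899 ∷ []) ∷ (2255 ∷ 977 ∷ 1893 ∷ 532 ∷ 1717 ∷ 639 ∷ 1205 ∷ []) ∷ (1465 ∷ 2196 ∷ 1813 ∷ 1992 ∷ 626 ∷ 2116 ∷ 921 ∷ []) ∷ (1818 ∷ 1212 ∷ 2144 ∷ 2156 ∷ 834 ∷ 1494 ∷ 257 ∷ []) ∷ (1560 ∷ 556 ∷ 139 ∷ 1122 ∷ 897 ∷ 945 ∷ 1450 ∷ []) ∷ (1344 ∷ 2026 ∷ 489 ∷ 488 ∷ 70 ∷ 2376 ∷ 2249 ∷ []) ∷ (843 ∷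 47 ∷ 1503 ∷ 1204 ∷ 1608 ∷ 1061 ∷ 2219 ∷ []) ∷ []) ∷ ((1385 ∷ 780 ∷ 2074 ∷ 179 ∷ 1042 ∷ 1889 ∷ 1206 ∷ []) ∷ (57 ∷ 1802 ∷ 1275 ∷ 68 ∷ 1079 ∷ 1003 ∷ 1213 ∷ []) ∷ (180 ∷ 1453 ∷ 2327 ∷ 1333 ∷ 2232 ∷ 55 ∷ 848 ∷ []) ∷ (360 ∷ 731 ∷ 1207 ∷ 6 ∷ 2382 ∷ 2306 ∷ 223 ∷ []) ∷ (1931 ∷ 1948 ∷ 1505 ∷ 2109 ∷ 404 ∷ 2253 ∷ 1214 ∷ []) ∷ (1222 ∷ 1059 ∷ 1446 ∷ 1859 ∷ 676 ∷ 1343 ∷ 1147 ∷ []) ∷ (1123 ∷ 1315 ∷ 1047 ∷ 1577 ∷ 1323 ∷ 916 ∷ 814 ∷ []) ∷ []) ∷ ((1714 ∷ 1623 ∷ 930 ∷ 1456 ∷ 1242 ∷ 616 ∷ 800 ∷ []) ∷ (884 ∷ 371 ∷ 525 ∷ 1592 ∷ 2383 ∷ 316 ∷ 661 ∷ []) ∷ (1043 ∷ 24 ∷ 2308 ∷ 996 ∷ 696 ∷ 1849 ∷ 1418 ∷ []) ∷ (1062 ∷ 236 ∷ 436 ∷ 413 ∷ 1267 ∷ 716 ∷ 147 ∷ []) ∷ (2191 ∷ 241 ∷ 131 ∷ 586 ∷ 2203 ∷ 2337 ∷ 248 ∷ []) ∷ (1803 ∷ 1693 ∷ 506 ∷ 1255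 ∷ 847 ∷ 1725 ∷ 1182 ∷ []) ∷ (1745 ∷ 1930 ∷ 1537 ∷ 1067 ∷ 2325 ∷ 553 ∷ 1692 ∷ []) ∷ []) ∷ ((899 ∷ 1382 ∷ 2333 ∷ 1096 ∷ 92 ∷ 1160 ∷ 2313 ∷ []) ∷ (1004 ∷ 1575 ∷ 550 ∷ 33 ∷ 854 ∷ 2242 ∷ 1888 ∷ []) ∷ (347 ∷ 451 ∷ 282 ∷ 455 ∷ 1960 ∷ 183 ∷ 368 ∷ []) ∷ (503 ∷ 2340 ∷ 1613 ∷ 749 ∷ 2392 ∷ 1270 ∷ 1907 ∷ []) ∷ (1019 ∷ 234 ∷ 2358 ∷ 2281 ∷ 1314 ∷ 1028 ∷ 1139 ∷ []) ∷ (301 ∷ 2051 ∷ 925 ∷ 2236 ∷ 1782 ∷ 576 ∷ 838 ∷ []) ∷ (2238 ∷ 154 ∷ 1116 ∷ 791 ∷ 390 ∷ 345 ∷ 2072 ∷ []) ∷ []) ∷ ((2371 ∷ 111 ∷ 2239 ∷ 572 ∷ 1554 ∷ 967 ∷ 577 ∷ []) ∷ (2304 ∷ 1844 ∷ 2017 ∷ 1936 ∷ 1643 ∷ 1629 ∷ 980 ∷ []) ∷ (1662 ∷ 1966 ∷ 2173 ∷ 266 ∷ 1441 ∷ 2115 ∷ 510 ∷ []) ∷ (2205 ∷ 1750 ∷ 1618 ∷ 1703 ∷ 2339 ∷ 1202 ∷ 654 ∷ []) ∷ (1319 ∷ 373 ∷ 1305 ∷ 2132 ∷ 2343 ∷ 11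 ∷ 1734 ∷ []) ∷ (875 ∷ 958 ∷ 1556 ∷ 1404 ∷ 1117 ∷ 1209 ∷ 828 ∷ []) ∷ (970 ∷ 1376 ∷ 2227 ∷ 877 ∷ 1388 ∷ 2096 ∷ 1707 ∷ []) ∷ []) ∷ []) ∷ (((1038 ∷ 672 ∷ 2184 ∷ 2125 ∷ 1826 ∷ 1755 ∷ 845 ∷ []) ∷ (2305 ∷ 2206 ∷ 2119 ∷ 1720 ∷ 1487 ∷ 2190 ∷ 1763 ∷ []) ∷ (1954 ∷ 1611 ∷ 319 ∷ 1509 ∷ 1310 ∷ 1820 ∷ 2117 ∷ []) ∷ (402 ∷ 1424 ∷ 674 ∷ 563 ∷ 607 ∷ 1779 ∷ 1786 ∷ []) ∷ (2143 ∷ 1794 ∷ 396 ∷ 1710 ∷ 63 ∷ 1908 ∷ 1543 ∷ []) ∷ (2241 ∷ 1470 ∷ 350 ∷ 1767 ∷ 1924 ∷ 1431 ∷ 799 ∷ []) ∷ (2292 ∷ 765 ∷ 1070 ∷ 772 ∷ 1538 ∷ 1429 ∷ 26 ∷ []) ∷ []) ∷ ((52 ∷ 2058 ∷ 1158 ∷ 1533 ∷ 2209 ∷ 909 ∷ 640 ∷ []) ∷ (1080 ∷ 1071 ∷ 1658 ∷ 281 ∷ 93 ∷ 1522 ∷ 7 ∷ []) ∷ (123 ∷ 2101 ∷ 1052 ∷ 1321 ∷ 1153 ∷ 1845 ∷ 2092 ∷ []) ∷ (579 ∷ 2029 ∷ 1624 ∷ 1466 ∷ 157 ∷ 2258 ∷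 1776 ∷ []) ∷ (1571 ∷ 1273 ∷ 648 ∷ 2110 ∷ 815 ∷ 290 ∷ 1341 ∷ []) ∷ (2042 ∷ 1904 ∷ 333 ∷ 2151 ∷ 279 ∷ 1540 ∷ 325 ∷ []) ∷ (251 ∷ 256 ∷ 2394 ∷ 2175 ∷ 703 ∷ 2317 ∷ 2075 ∷ []) ∷ []) ∷ ((589 ∷ 2328 ∷ 1401 ∷ 269 ∷ 224 ∷ 699 ∷ 590 ∷ []) ∷ (1970 ∷ 1499 ∷ 2395 ∷ 185 ∷ 1141 ∷ 2150 ∷ 2262 ∷ []) ∷ (509 ∷ 2103 ∷ 1832 ∷ 1861 ∷ 1106 ∷ 1876 ∷ 1100 ∷ []) ∷ (19 ∷ 212 ∷ 879 ∷ 2168 ∷ 578 ∷ 1660 ∷ 1186 ∷ []) ∷ (1136 ∷ 12 ∷ 2145 ∷ 173 ∷ 1279 ∷ 1621 ∷ 101 ∷ []) ∷ (2356 ∷ 1501 ∷ 431 ∷ 725 ∷ 1101 ∷ 2188 ∷ 1277 ∷ []) ∷ (341 ∷ 636 ∷ 1031 ∷ 155 ∷ 1478 ∷ 1236 ∷ 517 ∷ []) ∷ []) ∷ ((2381 ∷ 1944 ∷ 2179 ∷ 29 ∷ 2045 ∷ 819 ∷ 1968 ∷ []) ∷ (105 ∷ 200 ∷ 1010 ∷ 1681 ∷ 818 ∷ 1089 ∷ 2319 ∷ []) ∷ (2136 ∷ 1620 ∷ 2140 ∷ 478 ∷ 1155 ∷ 349 ∷ 1231 ∷ []) ∷ (156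 ∷ 1896 ∷ 1674 ∷ 637 ∷ 432 ∷ 1087 ∷ 1546 ∷ []) ∷ (523 ∷ 638 ∷ 794 ∷ 1532 ∷ 1666 ∷ 2159 ∷ 2025 ∷ []) ∷ (1739 ∷ 1824 ∷ 1318 ∷ 305 ∷ 867 ∷ 2348 ∷ 2149 ∷ []) ∷ (2280 ∷ 896 ∷ 583 ∷ 1355 ∷ 1352 ∷ 161 ∷ 1584 ∷ []) ∷ []) ∷ ((1631 ∷ 1934 ∷ 863 ∷ 746 ∷ 733 ∷ 1987 ∷ 882 ∷ []) ∷ (332 ∷ 1740 ∷ 2235 ∷ 1420 ∷ 138 ∷ 711 ∷ 459 ∷ []) ∷ (1759 ∷ 171 ∷ 499 ∷ 738 ∷ 190 ∷ 836 ∷ 2274 ∷ []) ∷ (942 ∷ 134 ∷ 1902 ∷ 1437 ∷ 905 ∷ 1488 ∷ 151 ∷ []) ∷ (1515 ∷ 1073 ∷ 2088 ∷ 821 ∷ 4 ∷ 1609 ∷ 1423 ∷ []) ∷ (2307 ∷ 634 ∷ 601 ∷ 2016 ∷ 1525 ∷ 1198 ∷ 1502 ∷ []) ∷ (144 ∷ 817 ∷ 727 ∷ 1881 ∷ 670 ∷ 1237 ∷ 928 ∷ []) ∷ []) ∷ ((348 ∷ 862 ∷ 384 ∷ 631 ∷ 1860 ∷ 695 ∷ 1438 ∷ []) ∷ (795 ∷ 1943 ∷ 1768 ∷ 2335 ∷ 1869 ∷ 975 ∷ 1113 ∷ []) ∷ (1610 ∷ 2309 ∷ 1064 ∷ 1134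 ∷ 1976 ∷ 1605 ∷ 213 ∷ []) ∷ (1132 ∷ 728 ∷ 16 ∷ 1422 ∷ 2302 ∷ 2081 ∷ 647 ∷ []) ∷ (1203 ∷ 722 ∷ 253 ∷ 1210 ∷ 1190 ∷ 959 ∷ 2099 ∷ []) ∷ (646 ∷ 1673 ∷ 275 ∷ 330 ∷ 1303 ∷ 1695 ∷ 1460 ∷ []) ∷ (1800 ∷ 502 ∷ 1929 ∷ 1175 ∷ 972 ∷ 2198 ∷ 366 ∷ []) ∷ []) ∷ ((1249 ∷ 748 ∷ 1506 ∷ 119 ∷ 842 ∷ 2373 ∷ 1058 ∷ []) ∷ (2018 ∷ 2347 ∷ 1738 ∷ 1462 ∷ 880 ∷ 178 ∷ 1016 ∷ []) ∷ (64 ∷ 2270 ∷ 1981 ∷ 1300 ∷ 36 ∷ 2170 ∷ 1483 ∷ []) ∷ (2216 ∷ 1034 ∷ 1346 ∷ 62 ∷ 1365 ∷ 392 ∷ 108 ∷ []) ∷ (2129 ∷ 1152 ∷ 1434 ∷ 1990 ∷ 2247 ∷ 1576 ∷ 961 ∷ []) ∷ (521 ∷ 2266 ∷ 254 ∷ 1572 ∷ 1635 ∷ 743 ∷ 2286 ∷ []) ∷ (1148 ∷ 217 ∷ 567 ∷ 2334 ∷ 1507 ∷ 537 ∷ 1287 ∷ []) ∷ []) ∷ []) ∷ (((820 ∷ 2386 ∷ 1164 ∷ 1639 ∷ 76 ∷ 1965 ∷ 1811 ∷ []) ∷ (1381 ∷ 1922 ∷ 994 ∷ 259 ∷ 1309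 ∷ 1458 ∷ 2022 ∷ []) ∷ (1283 ∷ 947 ∷ 2230 ∷ 2019 ∷ 308 ∷ 2183 ∷ 1582 ∷ []) ∷ (2254 ∷ 566 ∷ 1455 ∷ 363 ∷ 1873 ∷ 2185 ∷ 135 ∷ []) ∷ (1173 ∷ 192 ∷ 1665 ∷ 406 ∷ 750 ∷ 10 ∷ 1708 ∷ []) ∷ (1269 ∷ 1496 ∷ 687 ∷ 902 ∷ 172 ∷ 910 ∷ 1176 ∷ []) ∷ (386 ∷ 1536 ∷ 999 ∷ 1887 ∷ 433 ∷ 1498 ∷ 1984 ∷ []) ∷ []) ∷ ((1574 ∷ 2065 ∷ 1626 ∷ 2246 ∷ 697 ∷ 2218 ∷ 1856 ∷ []) ∷ (524 ∷ 713 ∷ 1232 ∷ 1701 ∷ 1566 ∷ 662 ∷ 351 ∷ []) ∷ (2374 ∷ 1427 ∷ 1473 ∷ 1541 ∷ 344 ∷ 2053 ∷ 1705 ∷ []) ∷ (470 ∷ 619 ∷ 1991 ∷ 215 ∷ 2021 ∷ 745 ∷ 658 ∷ []) ∷ (367 ∷ 1199 ∷ 1864 ∷ 1238 ∷ 1290 ∷ 1121 ∷ 535 ∷ []) ∷ (1615 ∷ 1529 ∷ 531 ∷ 1181 ∷ 1945 ∷ 189 ∷ 474 ∷ []) ∷ (541 ∷ 1480 ∷ 2009 ∷ 1050 ∷ 492 ∷ 613 ∷ 1885 ∷ []) ∷ []) ∷ ((338 ∷ 1846 ∷ 53 ∷ 75 ∷ 1596 ∷ 1709 ∷ 2102 ∷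 []) ∷ (1102 ∷ 149 ∷ 1372 ∷ 1017 ∷ 1855 ∷ 1475 ∷ 2321 ∷ []) ∷ (1777 ∷ 839 ∷ 714 ∷ 1775 ∷ 59 ∷ 181 ∷ 1815 ∷ []) ∷ (1633 ∷ 313 ∷ 1403 ∷ 706 ∷ 764 ∷ 995 ∷ 677 ∷ []) ∷ (923 ∷ 1282 ∷ 585 ∷ 1785 ∷ 1892 ∷ 121 ∷ 1622 ∷ []) ∷ (841 ∷ 1962 ∷ 963 ∷ 1251 ∷ 1521 ∷ 2389 ∷ 79 ∷ []) ∷ (581 ∷ 575 ∷ 469 ∷ 208 ∷ 1553 ∷ 88 ∷ 1827 ∷ []) ∷ []) ∷ ((726 ∷ 1512 ∷ 225 ∷ 1110 ∷ 692 ∷ 122 ∷ 2033 ∷ []) ∷ (454 ∷ 1081 ∷ 1440 ∷ 1753 ∷ 65 ∷ 280 ∷ 2083 ∷ []) ∷ (822 ∷ 415 ∷ 2047 ∷ 1599 ∷ 107 ∷ 1022 ∷ 1550 ∷ []) ∷ (2315 ∷ 1170 ∷ 1402 ∷ 680 ∷ 669 ∷ 868 ∷ 483 ∷ []) ∷ (71 ∷ 43 ∷ 293 ∷ 2189 ∷ 1688 ∷ 1286 ∷ 1795 ∷ []) ∷ (1900 ∷ 1007 ∷ 22 ∷ 1528 ∷ 113 ∷ 736 ∷ 1769 ∷ []) ∷ (1504 ∷ 1573 ∷ 2046 ∷ 1188 ∷ 2070 ∷ 853 ∷ 1706 ∷ []) ∷ []) ∷ ((2342 ∷ 2393 ∷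 1632 ∷ 2345 ∷ 1308 ∷ 922 ∷ 920 ∷ []) ∷ (825 ∷ 1606 ∷ 624 ∷ 1686 ∷ 38 ∷ 549 ∷ 2359 ∷ []) ∷ (797 ∷ 315 ∷ 250 ∷ 2295 ∷ 1956 ∷ 2391 ∷ 859 ∷ []) ∷ (2201 ∷ 1557 ∷ 1766 ∷ 1555 ∷ 1336 ∷ 1015 ∷ 1033 ∷ []) ∷ (263 ∷ 125 ∷ 480 ∷ 1935 ∷ 1225 ∷ 1184 ∷ 860 ∷ []) ∷ (793 ∷ 1163 ∷ 1228 ∷ 2375 ∷ 1838 ∷ 1911 ∷ 1668 ∷ []) ∷ (1026 ∷ 359 ∷ 663 ∷ 769 ∷ 222 ∷ 2195 ∷ 1451 ∷ []) ∷ []) ∷ ((1316 ∷ 1926 ∷ 327 ∷ 2388 ∷ 2069 ∷ 484 ∷ 1261 ∷ []) ∷ (2400 ∷ 1806 ∷ 608 ∷ 2197 ∷ 2231 ∷ 2087 ∷ 410 ∷ []) ∷ (1241 ∷ 205 ∷ 362 ∷ 1511 ∷ 1747 ∷ 302 ∷ 2077 ∷ []) ∷ (1748 ∷ 377 ∷ 114 ∷ 1154 ∷ 2207 ∷ 129 ∷ 2158 ∷ []) ∷ (98 ∷ 2133 ∷ 304 ∷ 449 ∷ 1910 ∷ 2323 ∷ 2056 ∷ []) ∷ (51 ∷ 2039 ∷ 720 ∷ 1413 ∷ 2365 ∷ 5 ∷ 1971 ∷ []) ∷ (788 ∷ 1426 ∷ 1111 ∷ 1103 ∷ 560 ∷ 1817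 ∷ 801 ∷ []) ∷ []) ∷ ((1035 ∷ 1414 ∷ 500 ∷ 1149 ∷ 635 ∷ 1012 ∷ 2118 ∷ []) ∷ (1444 ∷ 1030 ∷ 2194 ∷ 1040 ∷ 1109 ∷ 666 ∷ 2085 ∷ []) ∷ (456 ∷ 2378 ∷ 628 ∷ 495 ∷ 1461 ∷ 462 ∷ 2141 ∷ []) ∷ (1048 ∷ 1988 ∷ 1425 ∷ 693 ∷ 1001 ∷ 440 ∷ 1973 ∷ []) ∷ (471 ∷ 981 ∷ 2086 ∷ 48 ∷ 1865 ∷ 1649 ∷ 1392 ∷ []) ∷ (1002 ∷ 802 ∷ 2068 ∷ 73 ∷ 823 ∷ 826 ∷ 2142 ∷ []) ∷ (2157 ∷ 1252 ∷ 1932 ∷ 90 ∷ 206 ∷ 773 ∷ 1949 ∷ []) ∷ []) ∷ []) ∷ (((2229 ∷ 1657 ∷ 2271 ∷ 2399 ∷ 1395 ∷ 163 ∷ 2364 ∷ []) ∷ (1156 ∷ 760 ∷ 1669 ∷ 949 ∷ 602 ∷ 158 ∷ 268 ∷ []) ∷ (724 ∷ 690 ∷ 1743 ∷ 1150 ∷ 997 ∷ 1107 ∷ 2294 ∷ []) ∷ (2264 ∷ 1882 ∷ 689 ∷ 1675 ∷ 712 ∷ 870 ∷ 1263 ∷ []) ∷ (2034 ∷ 1368 ∷ 1583 ∷ 1086 ∷ 1128 ∷ 1870 ∷ 1337 ∷ []) ∷ (317 ∷ 729 ∷ 427 ∷ 1867 ∷ 2079 ∷ 2268 ∷ 1208 ∷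 []) ∷ (2148 ∷ 1364 ∷ 2257 ∷ 1407 ∷ 32 ∷ 443 ∷ 1804 ∷ []) ∷ []) ∷ ((1886 ∷ 15 ∷ 1060 ∷ 1857 ∷ 2297 ∷ 460 ∷ 1187 ∷ []) ∷ (2178 ∷ 2362 ∷ 1607 ∷ 993 ∷ 1781 ∷ 165 ∷ 393 ∷ []) ∷ (375 ∷ 1742 ∷ 614 ∷ 2296 ∷ 91 ∷ 742 ∷ 1875 ∷ []) ∷ (1542 ∷ 762 ∷ 2155 ∷ 1489 ∷ 562 ∷ 238 ∷ 1684 ∷ []) ∷ (507 ∷ 1617 ∷ 1292 ∷ 1901 ∷ 1075 ∷ 467 ∷ 1704 ∷ []) ∷ (1829 ∷ 1013 ∷ 128 ∷ 1796 ∷ 1218 ∷ 2250 ∷ 23 ∷ []) ∷ (2397 ∷ 965 ∷ 2024 ∷ 2061 ∷ 2349 ∷ 117 ∷ 2338 ∷ []) ∷ []) ∷ ((1463 ∷ 1416 ∷ 1280 ∷ 2032 ∷ 539 ∷ 700 ∷ 1133 ∷ []) ∷ (1227 ∷ 1964 ∷ 1393 ∷ 1791 ∷ 1481 ∷ 2084 ∷ 1495 ∷ []) ∷ (21 ∷ 1166 ∷ 2076 ∷ 952 ∷ 1918 ∷ 1842 ∷ 1244 ∷ []) ∷ (1411 ∷ 1585 ∷ 1866 ∷ 2011 ∷ 1830 ∷ 1032 ∷ 573 ∷ []) ∷ (512 ∷ 1361 ∷ 1115 ∷ 429 ∷ 288 ∷ 561 ∷ 2228 ∷ []) ∷ (929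 ∷ 1045 ∷ 804 ∷ 447 ∷ 956 ∷ 783 ∷ 864 ∷ []) ∷ (233 ∷ 1989 ∷ 1836 ∷ 1138 ∷ 785 ∷ 627 ∷ 126 ∷ []) ∷ []) ∷ ((957 ∷ 1145 ∷ 1302 ∷ 1284 ∷ 1358 ∷ 267 ∷ 1852 ∷ []) ∷ (1084 ∷ 230 ∷ 673 ∷ 152 ∷ 162 ∷ 1995 ∷ 1942 ∷ []) ∷ (1641 ∷ 849 ∷ 104 ∷ 1715 ∷ 2267 ∷ 665 ∷ 2010 ∷ []) ∷ (850 ∷ 515 ∷ 2160 ∷ 2093 ∷ 516 ∷ 170 ∷ 137 ∷ []) ∷ (807 ∷ 1812 ∷ 239 ∷ 1752 ∷ 2104 ∷ 2243 ∷ 2299 ∷ []) ∷ (296 ∷ 2314 ∷ 759 ∷ 1307 ∷ 504 ∷ 482 ∷ 314 ∷ []) ∷ (737 ∷ 2180 ∷ 398 ∷ 2147 ∷ 946 ∷ 1819 ∷ 1581 ∷ []) ∷ []) ∷ ((140 ∷ 2008 ∷ 2048 ∷ 1961 ∷ 552 ∷ 806 ∷ 1394 ∷ []) ∷ (416 ∷ 2066 ∷ 2037 ∷ 283 ∷ 873 ∷ 2062 ∷ 310 ∷ []) ∷ (1469 ∷ 1348 ∷ 835 ∷ 1905 ∷ 352 ∷ 195 ∷ 56 ∷ []) ∷ (935 ∷ 2361 ∷ 1196 ∷ 548 ∷ 1997 ∷ 321 ∷ 2282 ∷ []) ∷ (1831 ∷ 1443 ∷ 1011 ∷ 1756 ∷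 1256 ∷ 1265 ∷ 2163 ∷ []) ∷ (587 ∷ 164 ∷ 31 ∷ 81 ∷ 1702 ∷ 1928 ∷ 757 ∷ []) ∷ (1547 ∷ 450 ∷ 2272 ∷ 17 ∷ 1840 ∷ 339 ∷ 2208 ∷ []) ∷ []) ∷ ((953 ∷ 2336 ∷ 2287 ∷ 1077 ∷ 1240 ∷ 2244 ∷ 260 ∷ []) ∷ (2303 ∷ 1433 ∷ 1579 ∷ 1809 ∷ 1449 ∷ 774 ∷ 2311 ∷ []) ∷ (1370 ∷ 2363 ∷ 1969 ∷ 1088 ∷ 1957 ∷ 9 ∷ 1297 ∷ []) ∷ (1663 ∷ 2377 ∷ 210 ∷ 50 ∷ 1628 ∷ 618 ∷ 1580 ∷ []) ∷ (103 ∷ 1696 ∷ 1822 ∷ 496 ∷ 1823 ∷ 907 ∷ 2261 ∷ []) ∷ (1868 ∷ 96 ∷ 312 ∷ 1335 ∷ 604 ∷ 931 ∷ 808 ∷ []) ∷ (2049 ∷ 2379 ∷ 990 ∷ 933 ∷ 1588 ∷ 656 ∷ 588 ∷ []) ∷ []) ∷ ((1694 ∷ 1049 ∷ 2357 ∷ 1863 ∷ 869 ∷ 852 ∷ 1288 ∷ []) ∷ (1906 ∷ 763 ∷ 633 ∷ 232 ∷ 1578 ∷ 1398 ∷ 1354 ∷ []) ∷ (840 ∷ 1600 ∷ 518 ∷ 1124 ∷ 1677 ∷ 1485 ∷ 1410 ∷ []) ∷ (289 ∷ 979 ∷ 272 ∷ 1072 ∷ 2020 ∷ 383 ∷ 220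 ∷ []) ∷ (1248 ∷ 379 ∷ 1068 ∷ 342 ∷ 998 ∷ 1476 ∷ 331 ∷ []) ∷ (1383 ∷ 294 ∷ 1534 ∷ 219 ∷ 1347 ∷ 473 ∷ 1467 ∷ []) ∷ (1874 ∷ 153 ∷ 580 ∷ 2097 ∷ 1726 ∷ 1593 ∷ 0 ∷ []) ∷ []) ∷ []) ∷ [])

  log : Trie 7 4
  log = ((((0 ∷ 1554 ∷ 2354 ∷ 1954 ∷ 754 ∷ 1154 ∷ 354 ∷ []) ∷ (1836 ∷ 1908 ∷ 2192 ∷ 393 ∷ 490 ∷ 952 ∷ 1 ∷ []) ∷ (236 ∷ 1290 ∷ 308 ∷ 1752 ∷ 592 ∷ 801 ∷ 1193 ∷ []) ∷ (2236 ∷ 1352 ∷ 793 ∷ 2308 ∷ 401 ∷ 890 ∷ 192 ∷ []) ∷ (1036 ∷ 1392 ∷ 2090 ∷ 1601 ∷ 1108 ∷ 1993 ∷ 152 ∷ []) ∷ (1436 ∷ 2393 ∷ 2001 ∷ 1792 ∷ 552 ∷ 1508 ∷ 90 ∷ []) ∷ (636 ∷ 1201 ∷ 2152 ∷ 1690 ∷ 1593 ∷ 992 ∷ 708 ∷ []) ∷ []) ∷ ((2118 ∷ 935 ∷ 1223 ∷ 1590 ∷ 1603 ∷ 1729 ∷ 355 ∷ []) ∷ (2190 ∷ 2191 ∷ 1826 ∷ 1059 ∷ 365 ∷ 639 ∷ 1571 ∷ []) ∷ (74 ∷ 2262 ∷ 1361 ∷ 1166 ∷ 1240 ∷ 1817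 ∷ 2288 ∷ []) ∷ (675 ∷ 2340 ∷ 146 ∷ 1337 ∷ 350 ∷ 1460 ∷ 1513 ∷ []) ∷ (772 ∷ 414 ∷ 1799 ∷ 747 ∷ 430 ∷ 1490 ∷ 2295 ∷ []) ∷ (1234 ∷ 848 ∷ 240 ∷ 1569 ∷ 844 ∷ 807 ∷ 1031 ∷ []) ∷ (283 ∷ 1128 ∷ 1632 ∷ 1220 ∷ 627 ∷ 1306 ∷ 2140 ∷ []) ∷ []) ∷ ((518 ∷ 3 ∷ 1735 ∷ 129 ∷ 2023 ∷ 1155 ∷ 2390 ∷ []) ∷ (1572 ∷ 1230 ∷ 1214 ∷ 2290 ∷ 199 ∷ 695 ∷ 1547 ∷ []) ∷ (590 ∷ 1165 ∷ 591 ∷ 1439 ∷ 226 ∷ 2371 ∷ 1859 ∷ []) ∷ (2034 ∷ 1644 ∷ 1648 ∷ 1607 ∷ 1040 ∷ 1831 ∷ 2369 ∷ []) ∷ (874 ∷ 2040 ∷ 662 ∷ 217 ∷ 2161 ∷ 688 ∷ 1966 ∷ []) ∷ (1083 ∷ 1427 ∷ 1928 ∷ 2106 ∷ 32 ∷ 540 ∷ 2020 ∷ []) ∷ (1475 ∷ 1150 ∷ 740 ∷ 2260 ∷ 946 ∷ 2313 ∷ 2137 ∷ []) ∷ []) ∷ ((118 ∷ 2129 ∷ 1990 ∷ 1335 ∷ 755 ∷ 2003 ∷ 1623 ∷ []) ∷ (1634 ∷ 1207 ∷ 1969 ∷ 1248 ∷ 1431 ∷ 1244 ∷ 640 ∷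 []) ∷ (1075 ∷ 1860 ∷ 1737 ∷ 340 ∷ 1913 ∷ 750 ∷ 546 ∷ []) ∷ (190 ∷ 1039 ∷ 1459 ∷ 191 ∷ 1971 ∷ 765 ∷ 2226 ∷ []) ∷ (683 ∷ 1706 ∷ 1620 ∷ 1528 ∷ 140 ∷ 1027 ∷ 2032 ∷ []) ∷ (1172 ∷ 1890 ∷ 1147 ∷ 814 ∷ 295 ∷ 830 ∷ 2199 ∷ []) ∷ (474 ∷ 2217 ∷ 1566 ∷ 262 ∷ 288 ∷ 1640 ∷ 1761 ∷ []) ∷ []) ∷ ((1318 ∷ 423 ∷ 803 ∷ 1955 ∷ 135 ∷ 790 ∷ 929 ∷ []) ∷ (1674 ∷ 561 ∷ 440 ∷ 1488 ∷ 1462 ∷ 366 ∷ 1017 ∷ []) ∷ (2372 ∷ 999 ∷ 2030 ∷ 1495 ∷ 2014 ∷ 2347 ∷ 690 ∷ []) ∷ (1883 ∷ 832 ∷ 2227 ∷ 1340 ∷ 328 ∷ 420 ∷ 506 ∷ []) ∷ (1390 ∷ 1026 ∷ 1965 ∷ 771 ∷ 1391 ∷ 259 ∷ 2239 ∷ []) ∷ (2275 ∷ 1746 ∷ 1950 ∷ 713 ∷ 1540 ∷ 537 ∷ 660 ∷ []) ∷ (434 ∷ 1840 ∷ 44 ∷ 231 ∷ 48 ∷ 769 ∷ 7 ∷ []) ∷ []) ∷ ((1718 ∷ 1190 ∷ 2355 ∷ 823 ∷ 1329 ∷ 535 ∷ 1203 ∷ []) ∷ (275 ∷ 937 ∷ 1113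 ∷ 2146 ∷ 1060 ∷ 1940 ∷ 2350 ∷ []) ∷ (2283 ∷ 820 ∷ 1740 ∷ 1232 ∷ 906 ∷ 728 ∷ 227 ∷ []) ∷ (2074 ∷ 766 ∷ 1888 ∷ 961 ∷ 1417 ∷ 1862 ∷ 840 ∷ []) ∷ (834 ∷ 1169 ∷ 631 ∷ 2240 ∷ 407 ∷ 448 ∷ 444 ∷ []) ∷ (1790 ∷ 659 ∷ 1171 ∷ 1426 ∷ 239 ∷ 1791 ∷ 2365 ∷ []) ∷ (372 ∷ 347 ∷ 1895 ∷ 1399 ∷ 1090 ∷ 14 ∷ 30 ∷ []) ∷ []) ∷ ((918 ∷ 1555 ∷ 529 ∷ 403 ∷ 390 ∷ 23 ∷ 2135 ∷ []) ∷ (1483 ∷ 940 ∷ 106 ∷ 1827 ∷ 20 ∷ 432 ∷ 2328 ∷ []) ∷ (34 ∷ 2231 ∷ 2007 ∷ 2044 ∷ 369 ∷ 1440 ∷ 2048 ∷ []) ∷ (1972 ∷ 1095 ∷ 290 ∷ 1630 ∷ 1947 ∷ 599 ∷ 1614 ∷ []) ∷ (1875 ∷ 313 ∷ 260 ∷ 1550 ∷ 137 ∷ 1346 ∷ 1140 ∷ []) ∷ (1274 ∷ 1088 ∷ 617 ∷ 40 ∷ 2366 ∷ 161 ∷ 1062 ∷ []) ∷ (990 ∷ 371 ∷ 1839 ∷ 1565 ∷ 2259 ∷ 626 ∷ 991 ∷ []) ∷ []) ∷ []) ∷ (((0 ∷ 1482 ∷ 936 ∷ 439 ∷ 1247 ∷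 198 ∷ 638 ∷ []) ∷ (1217 ∷ 2120 ∷ 1986 ∷ 1445 ∷ 1215 ∷ 273 ∷ 1375 ∷ []) ∷ (1505 ∷ 1680 ∷ 1686 ∷ 1574 ∷ 1906 ∷ 1669 ∷ 341 ∷ []) ∷ (1872 ∷ 329 ∷ 1536 ∷ 1212 ∷ 981 ∷ 1077 ∷ 396 ∷ []) ∷ (1885 ∷ 1921 ∷ 1486 ∷ 449 ∷ 1134 ∷ 1660 ∷ 66 ∷ []) ∷ (2011 ∷ 18 ∷ 836 ∷ 759 ∷ 878 ∷ 1063 ∷ 94 ∷ []) ∷ (637 ∷ 564 ∷ 586 ∷ 1653 ∷ 1276 ∷ 2183 ∷ 2207 ∷ []) ∷ []) ∷ ((72 ∷ 2119 ∷ 911 ∷ 2310 ∷ 2270 ∷ 2208 ∷ 426 ∷ []) ∷ (73 ∷ 1289 ∷ 2006 ∷ 1231 ∷ 2013 ∷ 749 ∷ 1858 ∷ []) ∷ (2108 ∷ 1265 ∷ 1577 ∷ 2087 ∷ 1684 ∷ 1738 ∷ 1855 ∷ []) ∷ (1341 ∷ 358 ∷ 264 ∷ 1944 ∷ 1750 ∷ 1917 ∷ 1479 ∷ []) ∷ (647 ∷ 735 ∷ 408 ∷ 224 ∷ 1957 ∷ 378 ∷ 2125 ∷ []) ∷ (921 ∷ 2068 ∷ 2345 ∷ 558 ∷ 162 ∷ 2083 ∷ 2148 ∷ []) ∷ (1853 ∷ 2046 ∷ 1766 ∷ 1332 ∷ 858 ∷ 780 ∷ 709 ∷ []) ∷ [])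 ∷ ((356 ∷ 1093 ∷ 59 ∷ 114 ∷ 2184 ∷ 2212 ∷ 1925 ∷ []) ∷ (144 ∷ 1576 ∷ 1573 ∷ 1197 ∷ 1843 ∷ 1866 ∷ 427 ∷ []) ∷ (1643 ∷ 145 ∷ 2307 ∷ 1946 ∷ 1861 ∷ 505 ∷ 189 ∷ []) ∷ (1448 ∷ 2360 ∷ 2180 ∷ 743 ∷ 979 ∷ 1415 ∷ 2228 ∷ []) ∷ (1522 ∷ 2241 ∷ 1585 ∷ 1413 ∷ 888 ∷ 383 ∷ 2143 ∷ []) ∷ (2099 ∷ 2318 ∷ 1693 ∷ 2367 ∷ 719 ∷ 1282 ∷ 787 ∷ []) ∷ (170 ∷ 1500 ∷ 1881 ∷ 2324 ∷ 1103 ∷ 993 ∷ 471 ∷ []) ∷ []) ∷ ((957 ∷ 967 ∷ 1963 ∷ 1277 ∷ 2092 ∷ 2171 ∷ 1730 ∷ []) ∷ (222 ∷ 1548 ∷ 2337 ∷ 2174 ∷ 573 ∷ 2209 ∷ 242 ∷ []) ∷ (428 ∷ 742 ∷ 1749 ∷ 1076 ∷ 205 ∷ 1850 ∷ 62 ∷ []) ∷ (1619 ∷ 216 ∷ 429 ∷ 1992 ∷ 1139 ∷ 833 ∷ 1025 ∷ []) ∷ (632 ∷ 1931 ∷ 1715 ∷ 485 ∷ 64 ∷ 442 ∷ 1261 ∷ []) ∷ (1742 ∷ 568 ∷ 41 ∷ 1520 ∷ 1034 ∷ 246 ∷ 1697 ∷ []) ∷ (1795 ∷ 1003 ∷ 292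 ∷ 2038 ∷ 1594 ∷ 156 ∷ 110 ∷ []) ∷ []) ∷ ((1054 ∷ 954 ∷ 1654 ∷ 2104 ∷ 704 ∷ 1604 ∷ 1804 ∷ []) ∷ (696 ∷ 1878 ∷ 1538 ∷ 1819 ∷ 2271 ∷ 1814 ∷ 123 ∷ []) ∷ (2081 ∷ 159 ∷ 547 ∷ 55 ∷ 410 ∷ 1833 ∷ 1867 ∷ []) ∷ (1029 ∷ 63 ∷ 382 ∷ 2124 ∷ 1884 ∷ 526 ∷ 1695 ∷ []) ∷ (712 ∷ 294 ∷ 539 ∷ 1030 ∷ 1435 ∷ 1087 ∷ 1170 ∷ []) ∷ (1772 ∷ 618 ∷ 500 ∷ 1656 ∷ 16 ∷ 657 ∷ 665 ∷ []) ∷ (177 ∷ 1811 ∷ 2298 ∷ 1691 ∷ 1999 ∷ 1703 ∷ 25 ∷ []) ∷ []) ∷ ((1516 ∷ 587 ∷ 578 ∷ 1101 ∷ 1591 ∷ 2395 ∷ 2381 ∷ []) ∷ (1130 ∷ 1823 ∷ 1701 ∷ 2311 ∷ 784 ∷ 333 ∷ 200 ∷ []) ∷ (522 ∷ 751 ∷ 5 ∷ 621 ∷ 732 ∷ 1844 ∷ 1975 ∷ []) ∷ (1851 ∷ 988 ∷ 1420 ∷ 507 ∷ 1209 ∷ 79 ∷ 249 ∷ []) ∷ (1126 ∷ 656 ∷ 1696 ∷ 2098 ∷ 2067 ∷ 835 ∷ 1001 ∷ []) ∷ (1089 ∷ 768 ∷ 1760 ∷ 1474 ∷ 1127 ∷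 2151 ∷ 1564 ∷ []) ∷ (1313 ∷ 762 ∷ 2153 ∷ 315 ∷ 1651 ∷ 1397 ∷ 1069 ∷ []) ∷ []) ∷ ((565 ∷ 299 ∷ 594 ∷ 1224 ∷ 196 ∷ 533 ∷ 452 ∷ []) ∷ (1410 ∷ 457 ∷ 912 ∷ 1923 ∷ 352 ∷ 2291 ∷ 1782 ∷ []) ∷ (1914 ∷ 1755 ∷ 1052 ∷ 516 ∷ 1198 ∷ 2070 ∷ 2163 ∷ []) ∷ (1502 ∷ 297 ∷ 421 ∷ 1179 ∷ 37 ∷ 1161 ∷ 206 ∷ []) ∷ (909 ∷ 527 ∷ 969 ∷ 50 ∷ 445 ∷ 102 ∷ 1385 ∷ []) ∷ (1588 ∷ 1068 ∷ 176 ∷ 1002 ∷ 1880 ∷ 1331 ∷ 1275 ∷ []) ∷ (22 ∷ 1202 ∷ 1317 ∷ 2128 ∷ 1734 ∷ 1589 ∷ 753 ∷ []) ∷ []) ∷ []) ∷ (((800 ∷ 2047 ∷ 2282 ∷ 998 ∷ 1736 ∷ 1438 ∷ 1239 ∷ []) ∷ (285 ∷ 1934 ∷ 321 ∷ 60 ∷ 2286 ∷ 866 ∷ 1249 ∷ []) ∷ (2017 ∷ 2015 ∷ 520 ∷ 1073 ∷ 386 ∷ 2175 ∷ 2245 ∷ []) ∷ (411 ∷ 1678 ∷ 818 ∷ 1863 ∷ 1636 ∷ 894 ∷ 1559 ∷ []) ∷ (2305 ∷ 306 ∷ 80 ∷ 69 ∷ 86 ∷ 1141 ∷ 2374 ∷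 []) ∷ (1437 ∷ 2076 ∷ 1364 ∷ 583 ∷ 1386 ∷ 607 ∷ 53 ∷ []) ∷ (272 ∷ 1781 ∷ 1129 ∷ 1877 ∷ 2336 ∷ 1196 ∷ 2012 ∷ []) ∷ []) ∷ ((1854 ∷ 1504 ∷ 1754 ∷ 4 ∷ 54 ∷ 204 ∷ 504 ∷ []) ∷ (1512 ∷ 2235 ∷ 1094 ∷ 1887 ∷ 1339 ∷ 1970 ∷ 1830 ∷ []) ∷ (1496 ∷ 671 ∷ 278 ∷ 214 ∷ 2338 ∷ 923 ∷ 219 ∷ []) ∷ (172 ∷ 816 ∷ 1418 ∷ 1457 ∷ 1300 ∷ 1465 ∷ 56 ∷ []) ∷ (481 ∷ 1210 ∷ 959 ∷ 233 ∷ 1347 ∷ 267 ∷ 855 ∷ []) ∷ (977 ∷ 399 ∷ 211 ∷ 103 ∷ 698 ∷ 825 ∷ 91 ∷ []) ∷ (1829 ∷ 284 ∷ 863 ∷ 1326 ∷ 1182 ∷ 95 ∷ 524 ∷ []) ∷ []) ∷ ((872 ∷ 670 ∷ 519 ∷ 608 ∷ 1711 ∷ 1226 ∷ 710 ∷ []) ∷ (1447 ∷ 357 ∷ 1535 ∷ 1178 ∷ 1208 ∷ 525 ∷ 1024 ∷ []) ∷ (873 ∷ 413 ∷ 2089 ∷ 1549 ∷ 406 ∷ 258 ∷ 2031 ∷ []) ∷ (1721 ∷ 962 ∷ 468 ∷ 483 ∷ 745 ∷ 548 ∷ 1358 ∷ []) ∷ (508 ∷ 84 ∷ 2065 ∷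 138 ∷ 2377 ∷ 255 ∷ 487 ∷ []) ∷ (253 ∷ 1658 ∷ 446 ∷ 1580 ∷ 166 ∷ 1509 ∷ 2132 ∷ []) ∷ (2141 ∷ 150 ∷ 1158 ∷ 317 ∷ 1064 ∷ 2279 ∷ 344 ∷ []) ∷ []) ∷ ((2316 ∷ 2391 ∷ 1387 ∷ 795 ∷ 1378 ∷ 781 ∷ 1901 ∷ []) ∷ (1926 ∷ 467 ∷ 1456 ∷ 1635 ∷ 96 ∷ 1801 ∷ 498 ∷ []) ∷ (1930 ∷ 1584 ∷ 223 ∷ 1133 ∷ 101 ∷ 1000 ∷ 711 ∷ []) ∷ (1889 ∷ 1927 ∷ 1568 ∷ 551 ∷ 160 ∷ 2364 ∷ 2274 ∷ []) ∷ (1322 ∷ 1532 ∷ 1551 ∷ 244 ∷ 805 ∷ 375 ∷ 1421 ∷ []) ∷ (2113 ∷ 51 ∷ 1562 ∷ 2197 ∷ 553 ∷ 1869 ∷ 1115 ∷ []) ∷ (251 ∷ 2009 ∷ 1788 ∷ 879 ∷ 2220 ∷ 1049 ∷ 1307 ∷ []) ∷ []) ∷ ((1156 ∷ 584 ∷ 1893 ∷ 612 ∷ 859 ∷ 325 ∷ 914 ∷ []) ∷ (2322 ∷ 1688 ∷ 641 ∷ 1183 ∷ 2385 ∷ 543 ∷ 2213 ∷ []) ∷ (944 ∷ 243 ∷ 2376 ∷ 266 ∷ 2373 ∷ 1227 ∷ 1997 ∷ []) ∷ (499 ∷ 1519 ∷ 718 ∷ 2082 ∷ 93 ∷ 1587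 ∷ 767 ∷ []) ∷ (43 ∷ 261 ∷ 945 ∷ 1305 ∷ 707 ∷ 989 ∷ 346 ∷ []) ∷ (970 ∷ 1903 ∷ 2300 ∷ 1793 ∷ 281 ∷ 1271 ∷ 724 ∷ []) ∷ (2248 ∷ 1779 ∷ 760 ∷ 2215 ∷ 580 ∷ 628 ∷ 1543 ∷ []) ∷ []) ∷ ((1365 ∷ 996 ∷ 1099 ∷ 1333 ∷ 1394 ∷ 1252 ∷ 2024 ∷ []) ∷ (1709 ∷ 1245 ∷ 1327 ∷ 902 ∷ 1769 ∷ 2185 ∷ 850 ∷ []) ∷ (2210 ∷ 1152 ∷ 1257 ∷ 691 ∷ 1712 ∷ 182 ∷ 323 ∷ []) ∷ (2388 ∷ 280 ∷ 1868 ∷ 2131 ∷ 976 ∷ 2075 ∷ 1802 ∷ []) ∷ (314 ∷ 1998 ∷ 155 ∷ 470 ∷ 1852 ∷ 563 ∷ 1316 ∷ []) ∷ (822 ∷ 134 ∷ 2002 ∷ 2389 ∷ 2117 ∷ 1553 ∷ 528 ∷ []) ∷ (2302 ∷ 837 ∷ 1097 ∷ 1961 ∷ 1221 ∷ 1006 ∷ 1979 ∷ []) ∷ []) ∷ ((1757 ∷ 492 ∷ 1767 ∷ 571 ∷ 363 ∷ 130 ∷ 2077 ∷ []) ∷ (1432 ∷ 864 ∷ 331 ∷ 1242 ∷ 115 ∷ 2061 ∷ 1285 ∷ []) ∷ (1022 ∷ 1373 ∷ 2348 ∷ 609 ∷ 737 ∷ 1042 ∷ 574 ∷ []) ∷ (142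 ∷ 1834 ∷ 1368 ∷ 1046 ∷ 841 ∷ 97 ∷ 2320 ∷ []) ∷ (1228 ∷ 1005 ∷ 1542 ∷ 250 ∷ 149 ∷ 862 ∷ 1876 ∷ []) ∷ (195 ∷ 2394 ∷ 1803 ∷ 956 ∷ 1092 ∷ 910 ∷ 438 ∷ []) ∷ (19 ∷ 1939 ∷ 1016 ∷ 1633 ∷ 1229 ∷ 1825 ∷ 392 ∷ []) ∷ []) ∷ []) ∷ (((400 ∷ 598 ∷ 839 ∷ 1882 ∷ 1038 ∷ 1647 ∷ 1336 ∷ []) ∷ (11 ∷ 1463 ∷ 1159 ∷ 418 ∷ 494 ∷ 1278 ∷ 1236 ∷ []) ∷ (2272 ∷ 1477 ∷ 1612 ∷ 729 ∷ 796 ∷ 1381 ∷ 1936 ∷ []) ∷ (1617 ∷ 673 ∷ 1845 ∷ 120 ∷ 1775 ∷ 1615 ∷ 2386 ∷ []) ∷ (1037 ∷ 183 ∷ 2053 ∷ 964 ∷ 207 ∷ 1676 ∷ 986 ∷ []) ∷ (2285 ∷ 2060 ∷ 849 ∷ 2321 ∷ 466 ∷ 1534 ∷ 1886 ∷ []) ∷ (1905 ∷ 2069 ∷ 1974 ∷ 2080 ∷ 741 ∷ 2306 ∷ 2086 ∷ []) ∷ []) ∷ ((1916 ∷ 395 ∷ 1501 ∷ 987 ∷ 381 ∷ 1991 ∷ 978 ∷ []) ∷ (1489 ∷ 151 ∷ 1874 ∷ 1168 ∷ 1964 ∷ 1527 ∷ 2160 ∷ []) ∷ (2251 ∷ 479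 ∷ 907 ∷ 1388 ∷ 649 ∷ 1609 ∷ 1820 ∷ []) ∷ (1530 ∷ 733 ∷ 311 ∷ 2223 ∷ 600 ∷ 1184 ∷ 2101 ∷ []) ∷ (1713 ∷ 1797 ∷ 715 ∷ 1162 ∷ 1469 ∷ 2051 ∷ 153 ∷ []) ∷ (1526 ∷ 1235 ∷ 98 ∷ 1056 ∷ 1401 ∷ 67 ∷ 2096 ∷ []) ∷ (922 ∷ 2244 ∷ 1021 ∷ 1151 ∷ 2375 ∷ 1132 ∷ 405 ∷ []) ∷ []) ∷ ((1357 ∷ 171 ∷ 1677 ∷ 1367 ∷ 2130 ∷ 92 ∷ 2363 ∷ []) ∷ (2142 ∷ 646 ∷ 1920 ∷ 968 ∷ 2097 ∷ 1434 ∷ 441 ∷ []) ∷ (2019 ∷ 1233 ∷ 2392 ∷ 616 ∷ 1425 ∷ 1539 ∷ 829 ∷ []) ∷ (622 ∷ 209 ∷ 174 ∷ 1948 ∷ 642 ∷ 973 ∷ 337 ∷ []) ∷ (2195 ∷ 556 ∷ 38 ∷ 1403 ∷ 510 ∷ 1994 ∷ 692 ∷ []) ∷ (1032 ∷ 842 ∷ 885 ∷ 2331 ∷ 1661 ∷ 464 ∷ 2115 ∷ []) ∷ (828 ∷ 2250 ∷ 1476 ∷ 1142 ∷ 462 ∷ 605 ∷ 2149 ∷ []) ∷ []) ∷ ((472 ∷ 208 ∷ 310 ∷ 119 ∷ 826 ∷ 270 ∷ 1311 ∷ []) ∷ (1321 ∷ 83 ∷ 958 ∷ 68 ∷ 148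 ∷ 562 ∷ 345 ∷ []) ∷ (1741 ∷ 2317 ∷ 2344 ∷ 758 ∷ 1879 ∷ 2150 ∷ 664 ∷ []) ∷ (473 ∷ 1149 ∷ 1631 ∷ 1689 ∷ 2258 ∷ 13 ∷ 6 ∷ []) ∷ (2253 ∷ 1180 ∷ 1732 ∷ 46 ∷ 1109 ∷ 1258 ∷ 2166 ∷ []) ∷ (1047 ∷ 778 ∷ 624 ∷ 1135 ∷ 125 ∷ 2357 ∷ 808 ∷ []) ∷ (108 ∷ 2138 ∷ 87 ∷ 1665 ∷ 2255 ∷ 2084 ∷ 1977 ∷ []) ∷ []) ∷ ((965 ∷ 933 ∷ 1624 ∷ 699 ∷ 852 ∷ 596 ∷ 994 ∷ []) ∷ (1988 ∷ 1731 ∷ 1402 ∷ 1468 ∷ 1675 ∷ 2280 ∷ 576 ∷ []) ∷ (1902 ∷ 1561 ∷ 1579 ∷ 697 ∷ 606 ∷ 437 ∷ 821 ∷ []) ∷ (1810 ∷ 291 ∷ 2323 ∷ 857 ∷ 2182 ∷ 752 ∷ 1312 ∷ []) ∷ (422 ∷ 1989 ∷ 128 ∷ 1602 ∷ 1153 ∷ 2134 ∷ 1717 ∷ []) ∷ (1309 ∷ 502 ∷ 450 ∷ 927 ∷ 1785 ∷ 845 ∷ 1369 ∷ []) ∷ (2314 ∷ 70 ∷ 916 ∷ 2155 ∷ 163 ∷ 1598 ∷ 1452 ∷ []) ∷ []) ∷ ((1454 ∷ 2004 ∷ 104 ∷ 1354 ∷ 2204 ∷ 1104 ∷ 2054 ∷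 []) ∷ (2172 ∷ 1057 ∷ 2056 ∷ 1018 ∷ 1065 ∷ 416 ∷ 900 ∷ []) ∷ (1429 ∷ 926 ∷ 124 ∷ 463 ∷ 2095 ∷ 2284 ∷ 782 ∷ []) ∷ (1096 ∷ 2214 ∷ 2219 ∷ 2278 ∷ 523 ∷ 271 ∷ 1938 ∷ []) ∷ (577 ∷ 2103 ∷ 2091 ∷ 2211 ∷ 425 ∷ 2399 ∷ 298 ∷ []) ∷ (1112 ∷ 1487 ∷ 1430 ∷ 694 ∷ 1570 ∷ 1835 ∷ 939 ∷ []) ∷ (81 ∷ 2233 ∷ 455 ∷ 559 ∷ 2267 ∷ 810 ∷ 947 ∷ []) ∷ []) ∷ ((756 ∷ 212 ∷ 514 ∷ 1493 ∷ 2325 ∷ 184 ∷ 459 ∷ []) ∷ (99 ∷ 1682 ∷ 367 ∷ 318 ∷ 1187 ∷ 1119 ∷ 2093 ∷ []) ∷ (1848 ∷ 1815 ∷ 1143 ∷ 360 ∷ 228 ∷ 1379 ∷ 180 ∷ []) ∷ (544 ∷ 2266 ∷ 1597 ∷ 1976 ∷ 827 ∷ 2243 ∷ 1973 ∷ []) ∷ (570 ∷ 1393 ∷ 324 ∷ 1900 ∷ 871 ∷ 1503 ∷ 2281 ∷ []) ∷ (1922 ∷ 783 ∷ 1813 ∷ 241 ∷ 143 ∷ 1288 ∷ 1985 ∷ []) ∷ (2043 ∷ 905 ∷ 2346 ∷ 545 ∷ 589 ∷ 2261 ∷ 307 ∷ []) ∷ []) ∷ []) ∷ (((1600 ∷ 136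 ∷ 447 ∷ 2238 ∷ 682 ∷ 2039 ∷ 1798 ∷ []) ∷ (705 ∷ 886 ∷ 1106 ∷ 1941 ∷ 880 ∷ 774 ∷ 869 ∷ []) ∷ (1085 ∷ 686 ∷ 334 ∷ 1666 ∷ 1121 ∷ 2049 ∷ 860 ∷ []) ∷ (2237 ∷ 2186 ∷ 476 ∷ 1407 ∷ 2164 ∷ 853 ∷ 1383 ∷ []) ∷ (417 ∷ 1186 ∷ 415 ∷ 575 ∷ 1320 ∷ 645 ∷ 1873 ∷ []) ∷ (1072 ∷ 736 ∷ 181 ∷ 1996 ∷ 1929 ∷ 412 ∷ 277 ∷ []) ∷ (1211 ∷ 36 ∷ 78 ∷ 1694 ∷ 1618 ∷ 2359 ∷ 263 ∷ []) ∷ []) ∷ ((1956 ∷ 1659 ∷ 1384 ∷ 1125 ∷ 293 ∷ 1714 ∷ 1412 ∷ []) ∷ (843 ∷ 1507 ∷ 1061 ∷ 1789 ∷ 1745 ∷ 1146 ∷ 2105 ∷ []) ∷ (722 ∷ 785 ∷ 88 ∷ 1343 ∷ 1441 ∷ 613 ∷ 1983 ∷ []) ∷ (1770 ∷ 1081 ∷ 303 ∷ 2071 ∷ 700 ∷ 1524 ∷ 193 ∷ []) ∷ (1744 ∷ 773 ∷ 1043 ∷ 2027 ∷ 776 ∷ 397 ∷ 1066 ∷ []) ∷ (648 ∷ 1380 ∷ 179 ∷ 1428 ∷ 1560 ∷ 2343 ∷ 615 ∷ []) ∷ (1299 ∷ 893 ∷ 2319 ∷ 2387 ∷ 1518 ∷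 1567 ∷ 482 ∷ []) ∷ []) ∷ ((254 ∷ 854 ∷ 2304 ∷ 1004 ∷ 154 ∷ 1304 ∷ 804 ∷ []) ∷ (1281 ∷ 2147 ∷ 2010 ∷ 1067 ∷ 1759 ∷ 1655 ∷ 1033 ∷ []) ∷ (2312 ∷ 2139 ∷ 635 ∷ 370 ∷ 1894 ∷ 230 ∷ 287 ∷ []) ∷ (1777 ∷ 1498 ∷ 1199 ∷ 1625 ∷ 1011 ∷ 891 ∷ 903 ∷ []) ∷ (2296 ∷ 738 ∷ 1471 ∷ 1723 ∷ 1078 ∷ 1019 ∷ 1014 ∷ []) ∷ (229 ∷ 1982 ∷ 1084 ∷ 895 ∷ 1663 ∷ 1324 ∷ 2126 ∷ []) ∷ (972 ∷ 2100 ∷ 1616 ∷ 2265 ∷ 2218 ∷ 856 ∷ 2257 ∷ []) ∷ []) ∷ ((2165 ∷ 2194 ∷ 1796 ∷ 2052 ∷ 1899 ∷ 424 ∷ 2133 ∷ []) ∷ (1114 ∷ 252 ∷ 398 ∷ 1363 ∷ 955 ∷ 2116 ∷ 1270 ∷ []) ∷ (109 ∷ 169 ∷ 2045 ∷ 585 ∷ 2127 ∷ 1650 ∷ 1702 ∷ []) ∷ (1622 ∷ 517 ∷ 934 ∷ 2353 ∷ 402 ∷ 1328 ∷ 789 ∷ []) ∷ (610 ∷ 112 ∷ 1952 ∷ 982 ∷ 2057 ∷ 1123 ∷ 1491 ∷ []) ∷ (702 ∷ 2021 ∷ 1637 ∷ 1806 ∷ 1897 ∷ 379 ∷ 361 ∷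 []) ∷ (788 ∷ 1776 ∷ 1080 ∷ 475 ∷ 268 ∷ 202 ∷ 531 ∷ []) ∷ []) ∷ ((1672 ∷ 111 ∷ 1470 ∷ 2026 ∷ 1319 ∷ 1510 ∷ 1408 ∷ []) ∷ (1308 ∷ 777 ∷ 884 ∷ 1055 ∷ 465 ∷ 1287 ∷ 938 ∷ []) ∷ (2247 ∷ 2008 ∷ 1157 ∷ 1325 ∷ 2335 ∷ 1824 ∷ 1978 ∷ []) ∷ (1053 ∷ 966 ∷ 58 ∷ 2309 ∷ 1246 ∷ 532 ∷ 2380 ∷ []) ∷ (1673 ∷ 1206 ∷ 1213 ∷ 1058 ∷ 489 ∷ 431 ∷ 2349 ∷ []) ∷ (541 ∷ 1864 ∷ 950 ∷ 679 ∷ 1958 ∷ 1144 ∷ 1117 ∷ []) ∷ (121 ∷ 1545 ∷ 1762 ∷ 1348 ∷ 1268 ∷ 2158 ∷ 1283 ∷ []) ∷ []) ∷ ((157 ∷ 1163 ∷ 1292 ∷ 930 ∷ 167 ∷ 477 ∷ 1371 ∷ []) ∷ (2028 ∷ 949 ∷ 1805 ∷ 1662 ∷ 2342 ∷ 276 ∷ 1050 ∷ []) ∷ (2232 ∷ 915 ∷ 1664 ∷ 461 ∷ 1131 ∷ 2085 ∷ 2042 ∷ []) ∷ (995 ∷ 1892 ∷ 794 ∷ 1710 ∷ 203 ∷ 1238 ∷ 1756 ∷ []) ∷ (1822 ∷ 1537 ∷ 2173 ∷ 1842 ∷ 748 ∷ 1374 ∷ 1409 ∷ []) ∷ (819 ∷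 2029 ∷ 339 ∷ 225 ∷ 1816 ∷ 1192 ∷ 33 ∷ []) ∷ (942 ∷ 1641 ∷ 234 ∷ 897 ∷ 2168 ∷ 720 ∷ 1846 ∷ []) ∷ []) ∷ ((716 ∷ 2178 ∷ 791 ∷ 1581 ∷ 2187 ∷ 301 ∷ 1595 ∷ []) ∷ (2122 ∷ 1605 ∷ 2332 ∷ 1175 ∷ 2351 ∷ 2221 ∷ 1044 ∷ []) ∷ (326 ∷ 896 ∷ 1267 ∷ 201 ∷ 2256 ∷ 1298 ∷ 35 ∷ []) ∷ (513 ∷ 1353 ∷ 851 ∷ 269 ∷ 2362 ∷ 1915 ∷ 597 ∷ []) ∷ (330 ∷ 901 ∷ 2384 ∷ 1800 ∷ 1023 ∷ 1511 ∷ 1933 ∷ []) ∷ (1051 ∷ 620 ∷ 409 ∷ 1849 ∷ 188 ∷ 2107 ∷ 1679 ∷ []) ∷ (289 ∷ 960 ∷ 327 ∷ 764 ∷ 2368 ∷ 674 ∷ 1351 ∷ []) ∷ []) ∷ []) ∷ (((2000 ∷ 39 ∷ 238 ∷ 536 ∷ 2198 ∷ 1082 ∷ 847 ∷ []) ∷ (1472 ∷ 812 ∷ 2396 ∷ 1136 ∷ 677 ∷ 2329 ∷ 581 ∷ []) ∷ (237 ∷ 1253 ∷ 1807 ∷ 186 ∷ 1783 ∷ 164 ∷ 876 ∷ []) ∷ (1105 ∷ 1174 ∷ 2341 ∷ 1286 ∷ 1269 ∷ 1280 ∷ 1506 ∷ []) ∷ (1611 ∷ 359 ∷ 2094 ∷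 436 ∷ 663 ∷ 2018 ∷ 478 ∷ []) ∷ (817 ∷ 1045 ∷ 975 ∷ 1586 ∷ 2273 ∷ 1720 ∷ 815 ∷ []) ∷ (1485 ∷ 49 ∷ 2066 ∷ 1086 ∷ 1260 ∷ 1521 ∷ 734 ∷ []) ∷ []) ∷ ((557 ∷ 877 ∷ 1330 ∷ 1563 ∷ 1771 ∷ 567 ∷ 1692 ∷ []) ∷ (1219 ∷ 1592 ∷ 625 ∷ 29 ∷ 433 ∷ 2216 ∷ 739 ∷ []) ∷ (1395 ∷ 1638 ∷ 2110 ∷ 2292 ∷ 2156 ∷ 603 ∷ 1194 ∷ []) ∷ (28 ∷ 676 ∷ 2062 ∷ 1349 ∷ 1450 ∷ 342 ∷ 2205 ∷ []) ∷ (1342 ∷ 1120 ∷ 1297 ∷ 2041 ∷ 2246 ∷ 168 ∷ 634 ∷ []) ∷ (2222 ∷ 1774 ∷ 2242 ∷ 1937 ∷ 1809 ∷ 1148 ∷ 173 ∷ []) ∷ (232 ∷ 85 ∷ 861 ∷ 1315 ∷ 42 ∷ 1531 ∷ 2064 ∷ []) ∷ []) ∷ ((165 ∷ 824 ∷ 52 ∷ 194 ∷ 133 ∷ 2299 ∷ 2196 ∷ []) ∷ (1102 ∷ 779 ∷ 2206 ∷ 21 ∷ 761 ∷ 2297 ∷ 2037 ∷ []) ∷ (2022 ∷ 1728 ∷ 353 ∷ 917 ∷ 1189 ∷ 802 ∷ 1334 ∷ []) ∷ (1514 ∷ 116 ∷ 1763 ∷ 652 ∷ 1670 ∷ 1355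 ∷ 798 ∷ []) ∷ (1188 ∷ 602 ∷ 875 ∷ 2176 ∷ 931 ∷ 668 ∷ 1480 ∷ []) ∷ (1010 ∷ 1523 ∷ 1382 ∷ 512 ∷ 1891 ∷ 57 ∷ 2352 ∷ []) ∷ (509 ∷ 2050 ∷ 985 ∷ 569 ∷ 2102 ∷ 127 ∷ 45 ∷ []) ∷ []) ∷ ((2356 ∷ 2114 ∷ 1525 ∷ 2059 ∷ 1812 ∷ 693 ∷ 1784 ∷ []) ∷ (1048 ∷ 343 ∷ 1828 ∷ 1780 ∷ 1015 ∷ 1960 ∷ 579 ∷ []) ∷ (2170 ∷ 1924 ∷ 71 ∷ 1481 ∷ 593 ∷ 1100 ∷ 703 ∷ []) ∷ (1243 ∷ 1546 ∷ 2189 ∷ 1907 ∷ 105 ∷ 2145 ∷ 1461 ∷ []) ∷ (1699 ∷ 1967 ∷ 387 ∷ 1293 ∷ 882 ∷ 1918 ∷ 319 ∷ []) ∷ (2144 ∷ 797 ∷ 27 ∷ 1173 ∷ 1466 ∷ 1176 ∷ 1443 ∷ []) ∷ (1122 ∷ 1013 ∷ 1743 ∷ 1185 ∷ 2383 ∷ 1841 ∷ 488 ∷ []) ∷ []) ∷ ((1116 ∷ 701 ∷ 1981 ∷ 178 ∷ 1995 ∷ 187 ∷ 1191 ∷ []) ∷ (1451 ∷ 107 ∷ 2249 ∷ 1020 ∷ 2079 ∷ 588 ∷ 809 ∷ []) ∷ (913 ∷ 2315 ∷ 669 ∷ 1753 ∷ 997 ∷ 362 ∷ 1251 ∷ [])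 ∷ (122 ∷ 221 ∷ 1575 ∷ 2005 ∷ 1444 ∷ 351 ∷ 332 ∷ []) ∷ (689 ∷ 1074 ∷ 1164 ∷ 1360 ∷ 1751 ∷ 368 ∷ 727 ∷ []) ∷ (730 ∷ 1911 ∷ 2200 ∷ 1301 ∷ 2333 ∷ 1423 ∷ 384 ∷ []) ∷ (726 ∷ 1698 ∷ 601 ∷ 1296 ∷ 435 ∷ 256 ∷ 1667 ∷ []) ∷ []) ∷ ((2072 ∷ 1910 ∷ 26 ∷ 511 ∷ 1808 ∷ 1719 ∷ 1870 ∷ []) ∷ (941 ∷ 1544 ∷ 1079 ∷ 2264 ∷ 1517 ∷ 2358 ∷ 1350 ∷ []) ∷ (1453 ∷ 932 ∷ 309 ∷ 1366 ∷ 380 ∷ 1646 ∷ 458 ∷ []) ∷ (1708 ∷ 1687 ∷ 1455 ∷ 1177 ∷ 1338 ∷ 865 ∷ 1284 ∷ []) ∷ (521 ∷ 158 ∷ 1748 ∷ 1945 ∷ 1683 ∷ 1668 ∷ 2162 ∷ []) ∷ (2073 ∷ 831 ∷ 1458 ∷ 1606 ∷ 349 ∷ 889 ∷ 1613 ∷ []) ∷ (247 ∷ 2224 ∷ 1725 ∷ 8 ∷ 2378 ∷ 335 ∷ 1557 ∷ []) ∷ []) ∷ ((654 ∷ 1704 ∷ 1404 ∷ 1254 ∷ 1204 ∷ 554 ∷ 304 ∷ []) ∷ (629 ∷ 1724 ∷ 1295 ∷ 2382 ∷ 126 ∷ 2063 ∷ 1484 ∷ []) ∷ (2177 ∷ 1291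 ∷ 2025 ∷ 1898 ∷ 1303 ∷ 1411 ∷ 1599 ∷ []) ∷ (1681 ∷ 2055 ∷ 1467 ∷ 147 ∷ 1433 ∷ 2159 ∷ 10 ∷ []) ∷ (1372 ∷ 1256 ∷ 265 ∷ 100 ∷ 257 ∷ 218 ∷ 2016 ∷ []) ∷ (296 ∷ 1419 ∷ 2123 ∷ 1138 ∷ 1414 ∷ 1478 ∷ 1871 ∷ []) ∷ (312 ∷ 630 ∷ 770 ∷ 139 ∷ 687 ∷ 2294 ∷ 1035 ∷ []) ∷ []) ∷ []) ∷ (((1200 ∷ 1838 ∷ 1398 ∷ 47 ∷ 1639 ∷ 2136 ∷ 282 ∷ []) ∷ (1837 ∷ 1007 ∷ 983 ∷ 76 ∷ 453 ∷ 1786 ∷ 1764 ∷ []) ∷ (811 ∷ 1294 ∷ 2263 ∷ 2078 ∷ 1959 ∷ 2036 ∷ 1218 ∷ []) ∷ (685 ∷ 1266 ∷ 460 ∷ 2334 ∷ 1649 ∷ 286 ∷ 721 ∷ []) ∷ (672 ∷ 1596 ∷ 2277 ∷ 2181 ∷ 12 ∷ 336 ∷ 1529 ∷ []) ∷ (305 ∷ 1541 ∷ 469 ∷ 706 ∷ 374 ∷ 486 ∷ 480 ∷ []) ∷ (17 ∷ 175 ∷ 1473 ∷ 15 ∷ 245 ∷ 786 ∷ 920 ∷ []) ∷ []) ∷ ((1765 ∷ 1652 ∷ 1733 ∷ 1396 ∷ 24 ∷ 1794 ∷ 1499 ∷ []) ∷ (1222 ∷ 1953 ∷ 389 ∷ 534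 ∷ 928 ∷ 117 ∷ 2 ∷ []) ∷ (388 ∷ 75 ∷ 131 ∷ 680 ∷ 2202 ∷ 1376 ∷ 2268 ∷ []) ∷ (2109 ∷ 185 ∷ 1302 ∷ 1645 ∷ 1250 ∷ 2169 ∷ 1727 ∷ []) ∷ (302 ∷ 1406 ∷ 2361 ∷ 1237 ∷ 2379 ∷ 1621 ∷ 1497 ∷ []) ∷ (714 ∷ 963 ∷ 870 ∷ 2398 ∷ 1716 ∷ 2252 ∷ 555 ∷ []) ∷ (210 ∷ 582 ∷ 1091 ∷ 1552 ∷ 723 ∷ 2112 ∷ 1657 ∷ []) ∷ []) ∷ ((316 ∷ 1181 ∷ 1195 ∷ 391 ∷ 2301 ∷ 1778 ∷ 1787 ∷ []) ∷ (113 ∷ 2269 ∷ 197 ∷ 451 ∷ 1515 ∷ 953 ∷ 1962 ∷ []) ∷ (2289 ∷ 364 ∷ 951 ∷ 2327 ∷ 274 ∷ 560 ∷ 1968 ∷ []) ∷ (2326 ∷ 2201 ∷ 2035 ∷ 867 ∷ 898 ∷ 496 ∷ 1856 ∷ []) ∷ (651 ∷ 1449 ∷ 1279 ∷ 9 ∷ 1707 ∷ 220 ∷ 2188 ∷ []) ∷ (1722 ∷ 775 ∷ 644 ∷ 1932 ∷ 1821 ∷ 1205 ∷ 1951 ∷ []) ∷ (2330 ∷ 1400 ∷ 1533 ∷ 1984 ∷ 1111 ∷ 501 ∷ 623 ∷ []) ∷ []) ∷ ((2254 ∷ 604 ∷ 404 ∷ 1904 ∷ 904 ∷ 454 ∷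 2154 ∷ []) ∷ (1377 ∷ 1225 ∷ 503 ∷ 799 ∷ 491 ∷ 1098 ∷ 611 ∷ []) ∷ (572 ∷ 1865 ∷ 1857 ∷ 1216 ∷ 456 ∷ 1700 ∷ 1818 ∷ []) ∷ (1912 ∷ 2370 ∷ 2287 ∷ 235 ∷ 2230 ∷ 1739 ∷ 1494 ∷ []) ∷ (2229 ∷ 495 ∷ 1726 ∷ 684 ∷ 924 ∷ 1582 ∷ 1263 ∷ []) ∷ (881 ∷ 667 ∷ 633 ∷ 1610 ∷ 1255 ∷ 1747 ∷ 1359 ∷ []) ∷ (1896 ∷ 1323 ∷ 614 ∷ 1071 ∷ 619 ∷ 338 ∷ 678 ∷ []) ∷ []) ∷ ((2157 ∷ 530 ∷ 971 ∷ 892 ∷ 77 ∷ 763 ∷ 2167 ∷ []) ∷ (595 ∷ 1310 ∷ 1356 ∷ 394 ∷ 838 ∷ 1492 ∷ 2203 ∷ []) ∷ (542 ∷ 497 ∷ 1446 ∷ 2234 ∷ 320 ∷ 1241 ∷ 1768 ∷ []) ∷ (1832 ∷ 61 ∷ 1642 ∷ 1264 ∷ 1685 ∷ 515 ∷ 731 ∷ []) ∷ (419 ∷ 2225 ∷ 2033 ∷ 2339 ∷ 792 ∷ 1629 ∷ 1416 ∷ []) ∷ (1628 ∷ 1262 ∷ 650 ∷ 1405 ∷ 2276 ∷ 549 ∷ 1942 ∷ []) ∷ (1422 ∷ 1442 ∷ 1009 ∷ 1773 ∷ 974 ∷ 1137 ∷ 348 ∷ []) ∷ []) ∷ ((1556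 ∷ 725 ∷ 1012 ∷ 984 ∷ 1314 ∷ 1259 ∷ 2293 ∷ []) ∷ (1370 ∷ 1671 ∷ 2193 ∷ 2303 ∷ 1124 ∷ 681 ∷ 300 ∷ []) ∷ (899 ∷ 1987 ∷ 82 ∷ 1919 ∷ 1167 ∷ 493 ∷ 1118 ∷ []) ∷ (322 ∷ 943 ∷ 1583 ∷ 2088 ∷ 213 ∷ 385 ∷ 1041 ∷ []) ∷ (248 ∷ 1028 ∷ 215 ∷ 2179 ∷ 1943 ∷ 980 ∷ 1160 ∷ []) ∷ (443 ∷ 1389 ∷ 1705 ∷ 661 ∷ 746 ∷ 1107 ∷ 1345 ∷ []) ∷ (1344 ∷ 1627 ∷ 666 ∷ 643 ∷ 2397 ∷ 373 ∷ 376 ∷ []) ∷ []) ∷ ((1272 ∷ 1626 ∷ 1008 ∷ 1070 ∷ 1110 ∷ 2111 ∷ 919 ∷ []) ∷ (653 ∷ 1909 ∷ 1980 ∷ 2058 ∷ 132 ∷ 566 ∷ 846 ∷ []) ∷ (2121 ∷ 948 ∷ 883 ∷ 1362 ∷ 1758 ∷ 1145 ∷ 868 ∷ []) ∷ (1847 ∷ 925 ∷ 1578 ∷ 757 ∷ 1424 ∷ 1608 ∷ 1935 ∷ []) ∷ (141 ∷ 279 ∷ 717 ∷ 550 ∷ 744 ∷ 1464 ∷ 1558 ∷ []) ∷ (908 ∷ 655 ∷ 538 ∷ 484 ∷ 887 ∷ 377 ∷ 65 ∷ []) ∷ (1273 ∷ 658 ∷ 1949 ∷ 813 ∷ 31 ∷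 806 ∷ 89 ∷ []) ∷ []) ∷ []) ∷ [])

  open CyclotomicClasses 7 3 (# 1 ∷ # 1 ∷ # 0 ∷ # 0 ∷ []) (digits 7 4 2107) 480 antilog log

  witness : Witness
  witness = record
    { c = 4 ; a = digits 7 4 111 ; e₀ = 1 ; e₁ = 4 ; e₂ = 3
    ; A = List.map (digits 7 4) (1442 ∷ 2373 ∷ 687 ∷ 540 ∷ 1149 ∷ 1982 ∷ 575 ∷ 1170 ∷ 2011 ∷ 72 ∷ 2179 ∷ 1199 ∷ 1220 ∷ 1914 ∷ 2313 ∷ 409 ∷ 997 ∷ 185 ∷ 332 ∷ 1025 ∷ 522 ∷ 1166 ∷ 46 ∷ 732 ∷ 1083 ∷ 1181 ∷ 509 ∷ 1853 ∷ 2211 ∷ 363 ∷ 1497 ∷ 1658 ∷ 2057 ∷ []) }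

  notTotallySymmetric : ∀ ω → GF2401.PrimitiveRoot ω → ¬ GF2401.TotallySymmetric ω
  notTotallySymmetric = refutes⇒¬totallySymmetric (toWitness {a? = validTables?} _)
                                                  witness (toWitness {a? = refutes? witness} _)

module F256 where

  antilog : Trie 2 8
  antilog = ((((((((1 ∷ 153 ∷ []) ∷ (123 ∷ 182 ∷ []) ∷ []) ∷ ((221 ∷ 197 ∷ []) ∷ (168 ∷ 172 ∷ []) ∷ []) ∷ []) ∷ (((113 ∷ 59 ∷ []) ∷ (154 ∷ 112 ∷ []) ∷ []) ∷ ((187 ∷ 79 ∷ []) ∷ (185 ∷ 102 ∷ []) ∷ []) ∷ []) ∷ []) ∷ ((((200 ∷ 93 ∷ []) ∷ (213 ∷ 97 ∷ []) ∷ []) ∷ ((128 ∷ 174 ∷ []) ∷ (201 ∷ 196 ∷ []) ∷ []) ∷ []) ∷ (((68 ∷ 5 ∷ []) ∷ (30 ∷ 140 ∷ []) ∷ []) ∷ ((190 ∷ 132 ∷ []) ∷ (53 ∷ 62 ∷ []) ∷ []) ∷ []) ∷ []) ∷ []) ∷ (((((118 ∷ 217 ∷ []) ∷ (224 ∷ 95 ∷ []) ∷ []) ∷ ((158 ∷ 34 ∷ []) ∷ (204 ∷ 15 ∷ []) ∷ []) ∷ []) ∷ (((145 ∷ 100 ∷ []) ∷ (67 ∷ 231 ∷ []) ∷ []) ∷ ((119 ∷ 64 ∷ []) ∷ (155 ∷ 233 ∷ []) ∷ []) ∷ []) ∷ []) ∷ ((((10 ∷ 141 ∷ []) ∷ (3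 ∷ 176 ∷ []) ∷ []) ∷ ((19 ∷ 227 ∷ []) ∷ (124 ∷ 84 ∷ []) ∷ []) ∷ []) ∷ (((71 ∷ 181 ∷ []) ∷ (147 ∷ 77 ∷ []) ∷ []) ∷ ((194 ∷ 208 ∷ []) ∷ (214 ∷ 209 ∷ []) ∷ []) ∷ []) ∷ []) ∷ []) ∷ []) ∷ ((((((49 ∷ 108 ∷ []) ∷ (115 ∷ 18 ∷ []) ∷ []) ∷ ((92 ∷ 242 ∷ []) ∷ (26 ∷ 222 ∷ []) ∷ []) ∷ []) ∷ (((130 ∷ 135 ∷ []) ∷ (63 ∷ 179 ∷ []) ∷ []) ∷ ((116 ∷ 240 ∷ []) ∷ (22 ∷ 40 ∷ []) ∷ []) ∷ []) ∷ []) ∷ ((((148 ∷ 175 ∷ []) ∷ (207 ∷ 191 ∷ []) ∷ []) ∷ ((243 ∷ 188 ∷ []) ∷ (165 ∷ 195 ∷ []) ∷ []) ∷ []) ∷ (((48 ∷ 245 ∷ []) ∷ (8 ∷ 164 ∷ []) ∷ []) ∷ ((129 ∷ 55 ∷ []) ∷ (178 ∷ 114 ∷ []) ∷ []) ∷ []) ∷ []) ∷ []) ∷ (((((21 ∷ 152 ∷ []) ∷ (125 ∷ 205 ∷ []) ∷ []) ∷ ((251 ∷ 24 ∷ []) ∷ (80 ∷ 4 ∷ []) ∷ []) ∷ []) ∷ (((255 ∷ 74 ∷ []) ∷ (167 ∷ 234 ∷ []) ∷ []) ∷ ((36 ∷ 244 ∷ []) ∷ (14 ∷ 223 ∷ [])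 ∷ []) ∷ []) ∷ []) ∷ ((((241 ∷ 149 ∷ []) ∷ (83 ∷ 180 ∷ []) ∷ []) ∷ ((110 ∷ 46 ∷ []) ∷ (228 ∷ 13 ∷ []) ∷ []) ∷ []) ∷ (((99 ∷ 65 ∷ []) ∷ (157 ∷ 146 ∷ []) ∷ []) ∷ ((101 ∷ 58 ∷ []) ∷ (156 ∷ 11 ∷ []) ∷ []) ∷ []) ∷ []) ∷ []) ∷ []) ∷ []) ∷ (((((((192 ∷ 249 ∷ []) ∷ (32 ∷ 166 ∷ []) ∷ []) ∷ ((50 ∷ 220 ∷ []) ∷ (254 ∷ 211 ∷ []) ∷ []) ∷ []) ∷ (((225 ∷ 198 ∷ []) ∷ (162 ∷ 33 ∷ []) ∷ []) ∷ ((17 ∷ 202 ∷ []) ∷ (138 ∷ 35 ∷ []) ∷ []) ∷ []) ∷ []) ∷ ((((107 ∷ 229 ∷ []) ∷ (104 ∷ 85 ∷ []) ∷ []) ∷ ((215 ∷ 72 ∷ []) ∷ (171 ∷ 28 ∷ []) ∷ []) ∷ []) ∷ (((203 ∷ 237 ∷ []) ∷ (88 ∷ 160 ∷ []) ∷ []) ∷ ((252 ∷ 250 ∷ []) ∷ (42 ∷ 43 ∷ []) ∷ []) ∷ []) ∷ []) ∷ []) ∷ (((((151 ∷ 31 ∷ []) ∷ (66 ∷ 126 ∷ []) ∷ []) ∷ ((143 ∷ 232 ∷ []) ∷ (70 ∷ 44 ∷ []) ∷ []) ∷ []) ∷ (((163 ∷ 184 ∷ []) ∷ (189 ∷ 52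 ∷ []) ∷ []) ∷ ((87 ∷ 230 ∷ []) ∷ (98 ∷ 216 ∷ []) ∷ []) ∷ []) ∷ []) ∷ ((((193 ∷ 96 ∷ []) ∷ (91 ∷ 16 ∷ []) ∷ []) ∷ ((239 ∷ 25 ∷ []) ∷ (86 ∷ 127 ∷ []) ∷ []) ∷ []) ∷ (((144 ∷ 253 ∷ []) ∷ (56 ∷ 81 ∷ []) ∷ []) ∷ ((170 ∷ 133 ∷ []) ∷ (51 ∷ 69 ∷ []) ∷ []) ∷ []) ∷ []) ∷ []) ∷ []) ∷ ((((((7 ∷ 226 ∷ []) ∷ (122 ∷ 47 ∷ []) ∷ []) ∷ ((37 ∷ 109 ∷ []) ∷ (117 ∷ 105 ∷ []) ∷ []) ∷ []) ∷ (((76 ∷ 161 ∷ []) ∷ (235 ∷ 75 ∷ []) ∷ []) ∷ ((12 ∷ 246 ∷ []) ∷ (2 ∷ 41 ∷ []) ∷ []) ∷ []) ∷ []) ∷ ((((78 ∷ 136 ∷ []) ∷ (29 ∷ 60 ∷ []) ∷ []) ∷ ((173 ∷ 103 ∷ []) ∷ (73 ∷ 106 ∷ []) ∷ []) ∷ []) ∷ (((199 ∷ 27 ∷ []) ∷ (90 ∷ 137 ∷ []) ∷ []) ∷ ((23 ∷ 177 ∷ []) ∷ (139 ∷ 186 ∷ []) ∷ []) ∷ []) ∷ []) ∷ []) ∷ (((((89 ∷ 57 ∷ []) ∷ (150 ∷ 134 ∷ []) ∷ []) ∷ ((247 ∷ 238 ∷ []) ∷ (82 ∷ 45 ∷ [])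 ∷ []) ∷ []) ∷ (((218 ∷ 39 ∷ []) ∷ (210 ∷ 131 ∷ []) ∷ []) ∷ ((94 ∷ 219 ∷ []) ∷ (236 ∷ 169 ∷ []) ∷ []) ∷ []) ∷ []) ∷ ((((54 ∷ 142 ∷ []) ∷ (9 ∷ 61 ∷ []) ∷ []) ∷ ((121 ∷ 159 ∷ []) ∷ (111 ∷ 183 ∷ []) ∷ []) ∷ []) ∷ (((206 ∷ 38 ∷ []) ∷ (212 ∷ 248 ∷ []) ∷ []) ∷ ((120 ∷ 6 ∷ []) ∷ (20 ∷ 0 ∷ []) ∷ []) ∷ []) ∷ []) ∷ []) ∷ []) ∷ []) ∷ [])

  log : Trie 2 8
  log = ((((((((0 ∷ 40 ∷ []) ∷ (180 ∷ 1 ∷ []) ∷ []) ∷ ((65 ∷ 217 ∷ []) ∷ (141 ∷ 68 ∷ []) ∷ []) ∷ []) ∷ (((205 ∷ 29 ∷ []) ∷ (102 ∷ 188 ∷ []) ∷ []) ∷ ((26 ∷ 204 ∷ []) ∷ (208 ∷ 178 ∷ []) ∷ []) ∷ []) ∷ []) ∷ ((((90 ∷ 139 ∷ []) ∷ (169 ∷ 8 ∷ []) ∷ []) ∷ ((242 ∷ 96 ∷ []) ∷ (73 ∷ 165 ∷ []) ∷ []) ∷ []) ∷ (((166 ∷ 134 ∷ []) ∷ (89 ∷ 245 ∷ []) ∷ []) ∷ ((93 ∷ 149 ∷ []) ∷ (63 ∷ 223 ∷ []) ∷ []) ∷ []) ∷ []) ∷ []) ∷ (((((230 ∷ 184 ∷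 []) ∷ (24 ∷ 232 ∷ []) ∷ []) ∷ ((54 ∷ 218 ∷ []) ∷ (148 ∷ 110 ∷ []) ∷ []) ∷ []) ∷ (((127 ∷ 10 ∷ []) ∷ (236 ∷ 95 ∷ []) ∷ []) ∷ ((213 ∷ 206 ∷ []) ∷ (50 ∷ 182 ∷ []) ∷ []) ∷ []) ∷ []) ∷ ((((51 ∷ 216 ∷ []) ∷ (19 ∷ 100 ∷ []) ∷ []) ∷ ((229 ∷ 224 ∷ []) ∷ (130 ∷ 119 ∷ []) ∷ []) ∷ []) ∷ (((233 ∷ 126 ∷ []) ∷ (34 ∷ 161 ∷ []) ∷ []) ∷ ((203 ∷ 170 ∷ []) ∷ (108 ∷ 57 ∷ []) ∷ []) ∷ []) ∷ []) ∷ []) ∷ []) ∷ ((((((115 ∷ 18 ∷ []) ∷ (69 ∷ 60 ∷ []) ∷ []) ∷ ((164 ∷ 81 ∷ []) ∷ (117 ∷ 131 ∷ []) ∷ []) ∷ []) ∷ (((194 ∷ 222 ∷ []) ∷ (103 ∷ 87 ∷ []) ∷ []) ∷ ((33 ∷ 122 ∷ []) ∷ (250 ∷ 162 ∷ []) ∷ []) ∷ []) ∷ []) ∷ ((((12 ∷ 113 ∷ []) ∷ (150 ∷ 177 ∷ []) ∷ []) ∷ ((121 ∷ 61 ∷ []) ∷ (235 ∷ 214 ∷ []) ∷ []) ∷ []) ∷ (((98 ∷ 80 ∷ []) ∷ (91 ∷ 23 ∷ []) ∷ []) ∷ ((190 ∷ 251 ∷ []) ∷ (67 ∷ 185 ∷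 []) ∷ []) ∷ []) ∷ []) ∷ []) ∷ (((((191 ∷ 199 ∷ []) ∷ (101 ∷ 145 ∷ []) ∷ []) ∷ ((159 ∷ 193 ∷ []) ∷ (240 ∷ 181 ∷ []) ∷ []) ∷ []) ∷ (((114 ∷ 71 ∷ []) ∷ (109 ∷ 124 ∷ []) ∷ []) ∷ ((15 ∷ 192 ∷ []) ∷ (4 ∷ 179 ∷ []) ∷ []) ∷ []) ∷ []) ∷ ((((118 ∷ 143 ∷ []) ∷ (11 ∷ 31 ∷ []) ∷ []) ∷ ((174 ∷ 168 ∷ []) ∷ (46 ∷ 167 ∷ []) ∷ []) ∷ []) ∷ (((88 ∷ 36 ∷ []) ∷ (55 ∷ 226 ∷ []) ∷ []) ∷ ((248 ∷ 56 ∷ []) ∷ (197 ∷ 97 ∷ []) ∷ []) ∷ []) ∷ []) ∷ []) ∷ []) ∷ []) ∷ (((((((0 ∷ 58 ∷ []) ∷ (158 ∷ 13 ∷ []) ∷ []) ∷ ((209 ∷ 147 ∷ []) ∷ (200 ∷ 17 ∷ []) ∷ []) ∷ []) ∷ (((49 ∷ 20 ∷ []) ∷ (221 ∷ 252 ∷ []) ∷ []) ∷ ((2 ∷ 187 ∷ []) ∷ (16 ∷ 14 ∷ []) ∷ []) ∷ []) ∷ []) ∷ ((((79 ∷ 219 ∷ []) ∷ (107 ∷ 104 ∷ []) ∷ []) ∷ ((243 ∷ 247 ∷ []) ∷ (227 ∷ 244 ∷ []) ∷ []) ∷ []) ∷ (((173 ∷ 128 ∷ []) ∷ (7 ∷ 132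 ∷ []) ∷ []) ∷ ((135 ∷ 112 ∷ []) ∷ (47 ∷ 129 ∷ []) ∷ []) ∷ []) ∷ []) ∷ []) ∷ (((((152 ∷ 189 ∷ []) ∷ (253 ∷ 160 ∷ []) ∷ []) ∷ ((35 ∷ 106 ∷ []) ∷ (62 ∷ 137 ∷ []) ∷ []) ∷ []) ∷ (((6 ∷ 142 ∷ []) ∷ (201 ∷ 72 ∷ []) ∷ []) ∷ ((120 ∷ 156 ∷ []) ∷ (99 ∷ 154 ∷ []) ∷ []) ∷ []) ∷ []) ∷ ((((238 ∷ 140 ∷ []) ∷ (220 ∷ 198 ∷ []) ∷ []) ∷ ((231 ∷ 43 ∷ []) ∷ (163 ∷ 153 ∷ []) ∷ []) ∷ []) ∷ (((75 ∷ 94 ∷ []) ∷ (136 ∷ 32 ∷ []) ∷ []) ∷ ((207 ∷ 85 ∷ []) ∷ (70 ∷ 157 ∷ []) ∷ []) ∷ []) ∷ []) ∷ []) ∷ []) ∷ ((((((76 ∷ 215 ∷ []) ∷ (84 ∷ 234 ∷ []) ∷ []) ∷ ((241 ∷ 21 ∷ []) ∷ (30 ∷ 172 ∷ []) ∷ []) ∷ []) ∷ (((44 ∷ 92 ∷ []) ∷ (78 ∷ 225 ∷ []) ∷ []) ∷ ((125 ∷ 210 ∷ []) ∷ (66 ∷ 42 ∷ []) ∷ []) ∷ []) ∷ []) ∷ ((((254 ∷ 123 ∷ []) ∷ (211 ∷ 25 ∷ []) ∷ []) ∷ ((249 ∷ 105 ∷ []) ∷ (9 ∷ 83 ∷ [])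 ∷ []) ∷ []) ∷ (((155 ∷ 116 ∷ []) ∷ (77 ∷ 183 ∷ []) ∷ []) ∷ ((144 ∷ 48 ∷ []) ∷ (64 ∷ 38 ∷ []) ∷ []) ∷ []) ∷ []) ∷ []) ∷ (((((3 ∷ 146 ∷ []) ∷ (28 ∷ 27 ∷ []) ∷ []) ∷ ((151 ∷ 86 ∷ []) ∷ (171 ∷ 212 ∷ []) ∷ []) ∷ []) ∷ (((59 ∷ 5 ∷ []) ∷ (53 ∷ 41 ∷ []) ∷ []) ∷ ((186 ∷ 239 ∷ []) ∷ (52 ∷ 39 ∷ []) ∷ []) ∷ []) ∷ []) ∷ ((((228 ∷ 37 ∷ []) ∷ (176 ∷ 74 ∷ []) ∷ []) ∷ ((195 ∷ 138 ∷ []) ∷ (111 ∷ 45 ∷ []) ∷ []) ∷ []) ∷ (((133 ∷ 175 ∷ []) ∷ (196 ∷ 246 ∷ []) ∷ []) ∷ ((82 ∷ 202 ∷ []) ∷ (237 ∷ 22 ∷ []) ∷ []) ∷ []) ∷ []) ∷ []) ∷ []) ∷ []) ∷ [])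

  open CyclotomicClasses 2 7 (# 1 ∷ # 1 ∷ # 0 ∷ # 1 ∷ # 1 ∷ # 0 ∷ # 0 ∷ # 0 ∷ []) (digits 2 8 192) 51 antilog log

  witness : Witness
  witness = record
    { c = 4 ; a = digits 2 8 213 ; e₀ = 3 ; e₁ = 0 ; e₂ = 4
    ; A = List.map (digits 2 8) (28 ∷ 60 ∷ 26 ∷ 174 ∷ 153 ∷ 69 ∷ 109 ∷ 83 ∷ 251 ∷ []) }

  notTotallySymmetric : ∀ ω → GF256.PrimitiveRoot ω → ¬ GF256.TotallySymmetric ω
  notTotallySymmetric = refutes⇒¬totallySymmetric (toWitness {a? = validTables?} _)
                                                  witness (toWitness {a? = refutes? witness} _)

mainTheorem11 : (∀ ω → GF81.PrimitiveRoot ω → ¬ GF81.TotallySymmetric ω)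
                × (∀ ω → GF2401.PrimitiveRoot ω → ¬ GF2401.TotallySymmetric ω)
                × (∀ ω → GF256.PrimitiveRoot ω → ¬ GF256.TotallySymmetric ω)
mainTheorem11 = F81.notTotallySymmetric , F2401.notTotallySymmetric , F256.notTotallySymmetric
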